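{- Let $\varphi(X)$ be a formula of separator logic with one free set variable $X$ (and no other free variables). Then there exists a formula $\varphi'(x,\bar t)$ of separator logic, with free vertex variables $x$ and $\bar t$, such that for every graph $G$: if there exists $A\subseteq V(G)$ of rank $0$ with $G\models\varphi(A)$, then there exist $A'\subseteq V(G)$ of rank $0$ and an evaluation $\bar d$ of $\bar t$ such that $G\models\varphi(A')$ and $A'=\{v\in V(G): G\models\varphi'(v,\bar d)\}$.
   Context: Graphs are finite, simple, undirected, vertex-colored (finitely many unary predicates). The rank of $X\subseteq V(G)$ is the rank over $\mathbb F_2$ of the adjacency matrix between $X$ and $V(G)\setminus X$; rank $0$ means no edges between $X$ and its complement. Separator logic is first-order logic over graphs (free set variables with atoms $x\in X$ allowed) extended by predicates $\mathrm{conn}_k(s,t,a_1,\dots,a_k)$, $k\in\mathbb N$, holding iff there is a path with endpoints $s,t$ not passing through any of $a_1,\dots,a_k$. -}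

module Defs where

open import Data.Nat using (ℕ; zero; suc)
open import Data.Fin using (Fin; zero; suc)
open import Data.Vec using (Vec)
open import Data.Vec.Relation.Unary.Any using (Any)
open import Data.Bool using (Bool; true; false)
open import Data.Product using (Σ; _×_; _,_)
open import Data.Sum using (_⊎_)
open import Data.Unit using (⊤)
open import Data.Empty using (⊥)
open import Relation.Nullary using (¬_)
open import Relation.Binary.PropositionalEquality using (_≡_)

-- Finite simple undirected vertex-coloured graphs with c colour
-- predicates.  Vertex set is Fin (suc size) (nonempty, the usual
-- first-order convention).

record Graph (c : ℕ) : Set where
  field
    size      : ℕ
    adj       : Fin (suc size) → Fin (suc size) → Bool
    adj-sym   : ∀ u v → adj u v ≡ adj v u
    adj-irr   : ∀ v → adj v v ≡ false
    col       : Fin c → Fin (suc size) → Bool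

  V : Set
  V = Fin (suc size)

open Graph public

VSet : ∀ {c} → Graph c → Set
VSet G = V G → Bool

-- The adjacency matrix between X and V(G) ∖ X (over 𝔽₂, entries in Bool)
-- has rank 0, i.e. it is the zero matrix: no edge between X and its complement.
Rank0 : ∀ {c} (G : Graph c) → VSet G → Set
Rank0 G X = ∀ u w → X u ≡ true → X w ≡ false → adj G u w ≡ false

-- Walks in G all of whose vertices satisfy `ok`, from s to t.
-- (A path from s to t inside ok exists iff such a walk exists.)
data Walk {c} (G : Graph c) (ok : V G → Set) : V G → V G → Set where
  here : ∀ {v} → ok v → Walk G ok v v
  step : ∀ {u w v} → ok u → adj G u w ≡ true → Walk G ok w v → Walk G ok u v

-- Formula c v s : colours c, v free vertex variables, s free set variables
-- (de Bruijn indices; quantifiers bind vertex variable zero).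

data Formula (c v s : ℕ) : Set where
  tt ff  : Formula c v s
  _≐_    : Fin v → Fin v → Formula c v s
  edge   : Fin v → Fin v → Formula c v s
  colour : Fin c → Fin v → Formula c v s
  _∈ₛ_   : Fin v → Fin s → Formula c v s
  conn   : (k : ℕ) → Fin v → Fin v → Vec (Fin v) k → Formula c v s
  ¬f_    : Formula c v s → Formula c v s
  _∧f_ _∨f_ : Formula c v s → Formula c v s → Formula c v s
  ∃f ∀f  : Formula c (suc v) s → Formula c v s

extend : ∀ {v} {A : Set} → A → (Fin v → A) → Fin (suc v) → A
extend a ρ zero    = a
extend a ρ (suc i) = ρ i

⟦_⟧ : ∀ {c v s} → Formula c v s → (G : Graph c) →
      (Fin v → V G) → (Fin s → VSet G) → Set
⟦ tt ⟧ G ρ σ = ⊤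
⟦ ff ⟧ G ρ σ = ⊥
⟦ x ≐ y ⟧ G ρ σ = ρ x ≡ ρ y
⟦ edge x y ⟧ G ρ σ = adj G (ρ x) (ρ y) ≡ true
⟦ colour i x ⟧ G ρ σ = col G i (ρ x) ≡ true
⟦ x ∈ₛ X ⟧ G ρ σ = σ X (ρ x) ≡ true
⟦ conn k s t as ⟧ G ρ σ =
  Walk G (λ u → ¬ Any (λ a → ρ a ≡ u) as) (ρ s) (ρ t)
⟦ ¬f φ ⟧ G ρ σ = ¬ ⟦ φ ⟧ G ρ σ
⟦ φ ∧f ψ ⟧ G ρ σ = ⟦ φ ⟧ G ρ σ × ⟦ ψ ⟧ G ρ σ
⟦ φ ∨f ψ ⟧ G ρ σ = ⟦ φ ⟧ G ρ σ ⊎ ⟦ ψ ⟧ G ρ σ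
⟦ ∃f φ ⟧ G ρ σ = Σ (V G) λ a → ⟦ φ ⟧ G (extend a ρ) σ
⟦ ∀f φ ⟧ G ρ σ = (a : V G) → ⟦ φ ⟧ G (extend a ρ) σ

noVars : {A : Set} → Fin 0 → A
noVars ()

-- A set of rank 0 is a union of connected components, and conn_k only sees paths, so the truth of a
-- formula of quantifier rank Q in (G, A) is determined by counting, up to Q + 1, the components of each
-- rank-Q type and each colour (inside or outside A). This is an Ehrenfeucht–Fraïssé argument:
-- Duplicator answers a move inside an already pebbled component by the back-and-forth property of
-- local types, and a move into a fresh component by a fresh component of the same type and colour.
-- So A can be replaced type by type: if at most Q components of type τ lie in A, keep exactly these;
-- if at most Q lie outside A, keep all the others; otherwise keep Q + 1 of those in A. The resulting
-- A′ is named by at most Q + 1 representatives per type and one bit saying whether to complement,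
-- and component types are defined by Hintikka formulas, so A′ is defined by one formula whose
-- parameters encode the representatives and the bits.

module Submission where

open import Defs
open import Data.Bool using (Bool; true; false; not; _xor_; if_then_else_)
open import Data.Bool.Properties using (¬-not) renaming (_≟_ to _≟ᵇ_)
open import Data.Empty using (⊥-elim)
open import Data.Fin using (Fin; zero; suc; fromℕ; _↑ˡ_; _↑ʳ_; splitAt; combine; remQuot)
open import Data.Fin.Properties using (any?; all?; splitAt-↑ˡ; splitAt-↑ʳ; remQuot-combine)
  renaming (_≟_ to _≟ᶠ_)
open import Data.Fin.Subset using (Subset; _∈_; _-_; ∣_∣)
open import Data.Fin.Subset.Properties using (_∈?_; p─q⊆p; x∈p∧x≢y⇒x∈p-y; x∈p⇒∣p-x∣<∣p∣)
open import Data.List as List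
  using (List; []; _∷_; _++_; length; filter; allFin; cartesianProduct; cartesianProductWith)
open import Data.List.Membership.Propositional using () renaming (_∈_ to _∈ₗ_)
open import Data.List.Membership.Propositional.Properties
  using (∈-++⁺ˡ; ∈-++⁺ʳ; ∈-map⁺; ∈-allFin; ∈-cartesianProductWith⁺; ∈-cartesianProduct⁺)
open import Data.List.Properties using (filter-accept; filter-reject; filter-all)
open import Data.List.Relation.Unary.All as All using (All; []; _∷_)
open import Data.List.Relation.Unary.All.Properties using (all-filter; ¬Any⇒All¬)
  renaming (filter⁺ to All-filter⁺)
open import Data.List.Relation.Unary.AllPairs using (AllPairs; []; _∷_)
open import Data.List.Relation.Unary.AllPairs.Properties using () renaming (filter⁺ to AllPairs-filter⁺)
open import Data.List.Relation.Unary.Any as Anyₗ using ()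
open import Data.List.Relation.Unary.Any.Properties using (lookup-index)
open import Data.Nat using (ℕ; zero; suc; _+_; _*_; _⊔_; _≤_; _<_; _≤′_; ≤′-refl; ≤′-step; s≤s; z≤n)
open import Data.Nat.Induction using (<-wellFounded)
open import Data.Nat.Properties
  using (≤⇒≤′; ≤-refl; ≤-reflexive; ≤-pred; <⇒≤; m≤n⇒m≤1+n; m≤m+n; m⊔n≤o⇒m≤o; m⊔n≤o⇒n≤o;
         suc-injective; +-identityʳ; +-suc)
open import Data.Product using (Σ; _×_; _,_; proj₁; proj₂; uncurry; map₁; map₂)
open import Data.Product.Function.NonDependent.Propositional using (_×-⇔_)
open import Data.Sum using (_⊎_; inj₁; inj₂; [_,_]′)
open import Data.Sum.Function.Propositional using (_⊎-⇔_)
open import Data.Unit using (⊤; tt)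
open import Data.Vec as Vec using (Vec; []; _∷_; tabulate; lookup; here; there)
open import Data.Vec.Membership.Propositional using (find; lose)
open import Data.Vec.Properties
  using (lookup∘tabulate; tabulate∘lookup; tabulate-cong; []=↔lookup; ++-injectiveˡ; ++-injectiveʳ;
         take++drop≡id)
  renaming (≡-dec to ≡-decᵛ)
open import Data.Vec.Relation.Unary.Any as Any using (Any; here; there)
open import Function using (_∘_; const)
open import Function.Bundles using (_⇔_; Equivalence; Inverse; mk⇔)
open import Function.Properties.Equivalence using ()
  renaming (refl to ⇔-refl; sym to ⇔-sym; trans to ⇔-trans)
open import Function.Related.Propositional as Related using ()
open import Function.Related.TypeIsomorphisms using (¬-cong-⇔)
open import Induction.WellFounded using (Acc; acc)
open import Relation.Binary.PropositionalEquality using (_≡_; _≢_; refl; sym; trans; cong; cong₂; subst)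
open import Relation.Nullary using (¬_; Dec; yes; no; does; contradiction; ¬?; _×-dec_; _⊎-dec_)
open import Relation.Nullary.Decidable using (map′; does-⇔)
open import Relation.Unary using (Decidable)

open Equivalence using (to; from)
open Related.EquationalReasoning

Σ-cong-⇔ : {A : Set} {P Q : A → Set} → (∀ x → P x ⇔ Q x) → Σ A P ⇔ Σ A Q
Σ-cong-⇔ P⇔Q = mk⇔ (λ (x , p) → x , to (P⇔Q x) p) (λ (x , q) → x , from (P⇔Q x) q)

Π-cong-⇔ : {A : Set} {P Q : A → Set} → (∀ x → P x ⇔ Q x) → (∀ x → P x) ⇔ (∀ x → Q x)
Π-cong-⇔ P⇔Q = mk⇔ (λ p x → to (P⇔Q x) (p x)) (λ q x → from (P⇔Q x) (q x))

¬×¬⇒⇔ : {A B : Set} → ¬ A → ¬ B → A ⇔ B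
¬×¬⇒⇔ ¬a ¬b = mk⇔ (⊥-elim ∘ ¬a) (⊥-elim ∘ ¬b)

does≡true⇔ : {A : Set} (a? : Dec A) → (does a? ≡ true) ⇔ A
does≡true⇔ (yes a) = mk⇔ (const a) (const refl)
does≡true⇔ (no ¬a) = mk⇔ (λ ()) (⊥-elim ∘ ¬a)

does≡false⇔ : {A : Set} (a? : Dec A) → (does a? ≡ false) ⇔ (¬ A)
does≡false⇔ (yes a) = mk⇔ (λ ()) (λ ¬a → ⊥-elim (¬a a))
does≡false⇔ (no ¬a) = mk⇔ (const ¬a) (const refl)

does-≡⇒⇔ : {A B : Set} (a? : Dec A) (b? : Dec B) → does a? ≡ does b? → A ⇔ B
does-≡⇒⇔ (yes a) (yes b) _ = mk⇔ (const b) (const a)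
does-≡⇒⇔ (no ¬a) (no ¬b) _ = ¬×¬⇒⇔ ¬a ¬b

not-xor : ∀ β {x y} → (x ≡ true ⇔ y ≡ β) → not β xor x ≡ y
not-xor true  {true}  {true}  _ = refl
not-xor true  {false} {false} _ = refl
not-xor false {true}  {false} _ = refl
not-xor false {false} {true}  _ = refl
not-xor true  {true}  {false} x⇔y with to x⇔y refl
... | ()
not-xor true  {false} {true}  x⇔y with from x⇔y refl
... | ()
not-xor false {true}  {true}  x⇔y with to x⇔y refl
... | ()
not-xor false {false} {false} x⇔y with from x⇔y refl
... | ()

xor-⇔ : ∀ b n {P R : Set} → P ⇔ (b ≡ true) → R ⇔ (n ≡ true) →
  ((¬ P × R) ⊎ (P × ¬ R)) ⇔ (b xor n ≡ true)
xor-⇔ true  true  P⇔ R⇔ = mk⇔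
  (λ { (inj₁ (¬p , _)) → ⊥-elim (¬p (from P⇔ refl)) ; (inj₂ (_ , ¬r)) → ⊥-elim (¬r (from R⇔ refl)) }) λ ()
xor-⇔ true  false P⇔ R⇔ = mk⇔ (const refl) (const (inj₂ (from P⇔ refl , λ r → contradiction (to R⇔ r) λ ())))
xor-⇔ false true  P⇔ R⇔ = mk⇔ (const refl) (const (inj₁ ((λ p → contradiction (to P⇔ p) λ ()) , from R⇔ refl)))
xor-⇔ false false P⇔ R⇔ = mk⇔ (λ { (inj₁ (_ , r)) → to R⇔ r ; (inj₂ (p , _)) → to P⇔ p }) λ ()

_≟ᵛ_ : ∀ {n} (xs ys : Vec Bool n) → Dec (xs ≡ ys)
_≟ᵛ_ = ≡-decᵛ _≟ᵇ_

tabulate-≡⇔ : ∀ {A : Set} {n} (f : Fin n → A) (xs : Vec A n) → tabulate f ≡ xs ⇔ (∀ i → f i ≡ lookup xs i)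
tabulate-≡⇔ f xs = mk⇔
  (λ f≡xs i → trans (sym (lookup∘tabulate f i)) (cong (λ ys → lookup ys i) f≡xs))
  (λ f≗xs → trans (tabulate-cong f≗xs) (tabulate∘lookup xs))

++-≡⇔ : ∀ {A : Set} m {n} (xs : Vec A m) (ys : Vec A n) (zs : Vec A (m + n)) →
  xs Vec.++ ys ≡ zs ⇔ (xs ≡ Vec.take m zs × ys ≡ Vec.drop m zs)
++-≡⇔ m xs ys zs = mk⇔
  (λ e → let e′ = trans e (sym (take++drop≡id m zs)) in ++-injectiveˡ xs _ e′ , ++-injectiveʳ xs _ e′)
  (λ (xs≡ , ys≡) → trans (cong₂ Vec._++_ xs≡ ys≡) (take++drop≡id m zs))

Any-map⇔ : ∀ {A B : Set} {P : B → Set} (h : A → B) {k} (xs : Vec A k) →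
  Any P (Vec.map h xs) ⇔ Any (P ∘ h) xs
Any-map⇔ h xs = mk⇔ (to′ xs) (from′ xs)
  where
    to′ : ∀ {k} (xs : Vec _ k) → Any _ (Vec.map h xs) → Any _ xs
    to′ (x ∷ xs) (here p)  = here p
    to′ (x ∷ xs) (there q) = there (to′ xs q)
    from′ : ∀ {k} (xs : Vec _ k) → Any _ xs → Any _ (Vec.map h xs)
    from′ (x ∷ xs) (here p)  = here p
    from′ (x ∷ xs) (there q) = there (from′ xs q)

∈⇔lookup : ∀ {n} {S : Subset n} {i} → i ∈ S ⇔ lookup S i ≡ true
∈⇔lookup = mk⇔ (Inverse.to []=↔lookup) (Inverse.from []=↔lookup)

∈-tabulate⇔ : ∀ {n} (f : Fin n → Bool) {i} → i ∈ tabulate f ⇔ f i ≡ true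
∈-tabulate⇔ f {i} = ⇔-trans ∈⇔lookup (mk⇔ (trans (sym (lookup∘tabulate f i))) (trans (lookup∘tabulate f i)))

pullback : ∀ {m n} → (Fin m → Fin n) → Subset n → Subset m
pullback f S = tabulate (lookup S ∘ f)

∈-pullback⇔ : ∀ {m n} (f : Fin m → Fin n) {S : Subset n} {l} → l ∈ pullback f S ⇔ f l ∈ S
∈-pullback⇔ f {S} = ⇔-trans (∈-tabulate⇔ (lookup S ∘ f)) (⇔-sym ∈⇔lookup)

elements : ∀ {w} (S : Subset w) → Vec (Fin w) ∣ S ∣
elements []          = []
elements (true ∷ S)  = zero ∷ Vec.map suc (elements S)
elements (false ∷ S) = Vec.map suc (elements S)

Any-elements⇔ : ∀ {w} (S : Subset w) {P : Fin w → Set} → Any P (elements S) ⇔ Σ (Fin w) (λ l → l ∈ S × P l)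
Any-elements⇔ [] = mk⇔ (λ ()) (λ ())
Any-elements⇔ (true ∷ S) = mk⇔
  (λ { (here p) → zero , here , p ; (there q) → shift (to tail⇔ q) })
  (λ { (zero , _ , p) → here p ; (suc l , there l∈S , p) → there (from tail⇔ (l , l∈S , p)) })
  where
    tail⇔ = ⇔-trans (Any-map⇔ suc (elements S)) (Any-elements⇔ S)
    shift = λ (l , l∈S , p) → suc l , there l∈S , p
Any-elements⇔ (false ∷ S) = mk⇔
  (λ q → let l , l∈S , p = to tail⇔ q in suc l , there l∈S , p)
  (λ { (suc l , there l∈S , p) → from tail⇔ (l , l∈S , p) })
  where tail⇔ = ⇔-trans (Any-map⇔ suc (elements S)) (Any-elements⇔ S)

allVecs : ∀ n → List (Vec Bool n)
allVecs zero    = List.[ [] ]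
allVecs (suc n) = List.map (true ∷_) (allVecs n) ++ List.map (false ∷_) (allVecs n)

∈-allVecs : ∀ {n} (bs : Vec Bool n) → bs ∈ₗ allVecs n
∈-allVecs []                   = Anyₗ.here refl
∈-allVecs {suc n} (true ∷ bs)  = ∈-++⁺ˡ (∈-map⁺ (true ∷_) (∈-allVecs bs))
∈-allVecs {suc n} (false ∷ bs) = ∈-++⁺ʳ (List.map (true ∷_) (allVecs n)) (∈-map⁺ (false ∷_) (∈-allVecs bs))

module Enumeration {B : Set} (enum : List B) (complete : ∀ b → b ∈ₗ enum) where

  χ : {P : B → Set} → Decidable P → Vec Bool (length enum)
  χ P? = tabulate (λ k → does (P? (List.lookup enum k)))

  χ-≡⇔ : {P Q : B → Set} (P? : Decidable P) (Q? : Decidable Q) → χ P? ≡ χ Q? ⇔ (∀ b → P b ⇔ Q b)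
  χ-≡⇔ {P} {Q} P? Q? = mk⇔
    (λ χ≡ b → subst (λ b′ → P b′ ⇔ Q b′) (sym (lookup-index (complete b)))
                 (does-≡⇒⇔ (P? _) (Q? _) (at (Anyₗ.index (complete b)) χ≡)))
    (λ P⇔Q → tabulate-cong λ k → does-⇔ (P⇔Q _) (P? _) (Q? _))
    where
      at : ∀ k → χ P? ≡ χ Q? → does (P? (List.lookup enum k)) ≡ does (Q? (List.lookup enum k))
      at k χ≡ = trans (sym (lookup∘tabulate (does ∘ P? ∘ List.lookup enum) k))
                 (trans (cong (λ bs → lookup bs k) χ≡) (lookup∘tabulate (does ∘ Q? ∘ List.lookup enum) k))

slotOf : ∀ {S} {X : Set} → X → List X → Fin S → X
slotOf x₀ []       l       = x₀
slotOf x₀ (x ∷ xs) zero    = x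
slotOf x₀ (x ∷ xs) (suc l) = slotOf x₀ xs l

occupied : ∀ {S} {X : Set} → List X → Fin S → Bool
occupied []       l       = false
occupied (x ∷ xs) zero    = true
occupied (x ∷ xs) (suc l) = occupied xs l

slots-Any⇔ : ∀ {S} {X : Set} (R : X → Set) x₀ (xs : List X) → length xs ≤ S →
  Σ (Fin S) (λ l → occupied xs l ≡ true × R (slotOf x₀ xs l)) ⇔ Anyₗ.Any R xs
slots-Any⇔ R x₀ [] _ = mk⇔ (λ ()) (λ ())
slots-Any⇔ {suc S} R x₀ (x ∷ xs) (s≤s |xs|≤S) = mk⇔
  (λ { (zero , _ , r) → Anyₗ.here r ; (suc l , o , r) → Anyₗ.there (to tail⇔ (l , o , r)) })
  (λ { (Anyₗ.here r) → zero , refl , r ; (Anyₗ.there any) → let l , o , r = from tail⇔ any in suc l , o , r })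
  where tail⇔ = slots-Any⇔ R x₀ xs |xs|≤S

module Connectivity {c} (G : Graph c) where

  Vertex : Set
  Vertex = V G

  variable
    ok ok′ : Vertex → Set
    s t u : Vertex

  walk-map : (∀ {u} → ok u → ok′ u) → Walk G ok s t → Walk G ok′ s t
  walk-map f (here o)     = here (f o)
  walk-map f (step o a W) = step (f o) a (walk-map f W)

  walk-cong : (∀ u → ok u ⇔ ok′ u) → Walk G ok s t ⇔ Walk G ok′ s t
  walk-cong ok⇔ok′ = mk⇔ (walk-map (to (ok⇔ok′ _))) (walk-map (from (ok⇔ok′ _)))

  walk-source : Walk G ok s t → ok s
  walk-source (here o)     = o
  walk-source (step o _ _) = o

  walk-snoc : Walk G ok s t → ok u → adj G t u ≡ true → Walk G ok s u
  walk-snoc (here o)     o′ a′ = step o a′ (here o′)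
  walk-snoc (step o a W) o′ a′ = step o a (walk-snoc W o′ a′)

  walk-reverse : Walk G ok s t → Walk G ok t s
  walk-reverse (here o) = here o
  walk-reverse {s = s} (step {w = w} o a W) = walk-snoc (walk-reverse W) o (trans (adj-sym G w s) a)

  walk-++ : Walk G ok s t → Walk G ok t u → Walk G ok s u
  walk-++ (here _)     W′ = W′
  walk-++ (step o a W) W′ = step o a (walk-++ W W′)

  infix 4 _~_ _≁_
  _~_ : Vertex → Vertex → Set
  s ~ t = Walk G (const ⊤) s t

  _≁_ : Vertex → Vertex → Set
  s ≁ t = ¬ s ~ t

  ~-refl : s ~ s
  ~-refl = here tt

  ~-sym : s ~ t → t ~ s
  ~-sym = walk-reverse

  ~-trans : s ~ t → t ~ u → s ~ u
  ~-trans = walk-++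

  walk⇒~ : Walk G ok s t → s ~ t
  walk⇒~ = walk-map (const tt)

  adj⇒~ : adj G s t ≡ true → s ~ t
  adj⇒~ a = step tt a ~-refl

  walk-in-component : Walk G ok s t → Walk G (λ z → ok z × s ~ z) s t
  walk-in-component = go ~-refl
    where
      go : s ~ u → Walk G ok u t → Walk G (λ z → ok z × s ~ z) u t
      go s~u (here o)     = here (o , s~u)
      go s~u (step o a W) = step (o , s~u) a (go (~-trans s~u (adj⇒~ a)) W)

  Exit : (Vertex → Set) → Vertex → Vertex → Set
  Exit ok s t = Σ Vertex λ w → adj G s w ≡ true × Walk G (λ z → ok z × z ≢ s) w t

  avoids-or-exits : ∀ {s t} → s ≢ t → Walk G ok u t → Walk G (λ z → ok z × z ≢ s) u t ⊎ Exit ok s t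
  avoids-or-exits s≢t (here o) = inj₁ (here (o , s≢t ∘ sym))
  avoids-or-exits {u = u} {s = s} s≢t (step {w = w} o a W) with avoids-or-exits s≢t W
  ... | inj₂ e  = inj₂ e
  ... | inj₁ W′ with u ≟ᶠ s
  ...   | yes refl = inj₂ (w , a , W′)
  ...   | no u≢s   = inj₁ (step (o , u≢s) a W′)

  last-exit : s ≢ t → Walk G ok s t → Exit ok s t
  last-exit s≢t W with avoids-or-exits s≢t W
  ... | inj₁ W′ = ⊥-elim (proj₂ (walk-source W′) refl)
  ... | inj₂ e  = e

  -- Either s = t, or a walk leaves s for the last time and then stays in p - s.
  walk-within? : (p : Subset (suc (size G))) → Acc _<_ ∣ p ∣ → ∀ s t → Dec (Walk G (_∈ p) s t)
  walk-within? p (acc smaller) s t with s ∈? p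
  ... | no s∉p = no (s∉p ∘ walk-source)
  ... | yes s∈p with s ≟ᶠ t
  ...   | yes refl = yes (here s∈p)
  ...   | no s≢t   = map′ exit⇒walk walk⇒exit
          (any? λ w → (adj G s w ≟ᵇ true) ×-dec walk-within? (p - s) (smaller (x∈p⇒∣p-x∣<∣p∣ s∈p)) w t)
    where
      exit⇒walk : Σ Vertex (λ w → adj G s w ≡ true × Walk G (_∈ p - s) w t) → Walk G (_∈ p) s t
      exit⇒walk (w , a , W) = step s∈p a (walk-map (p─q⊆p p _) W)
      walk⇒exit : Walk G (_∈ p) s t → Σ Vertex (λ w → adj G s w ≡ true × Walk G (_∈ p - s) w t)
      walk⇒exit W with last-exit s≢t W
      ... | w , a , W′ = w , a , walk-map (uncurry x∈p∧x≢y⇒x∈p-y) W′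

  walk? : Decidable ok → ∀ s t → Dec (Walk G ok s t)
  walk? {ok = ok} ok? s t =
    map′ (walk-map (to ∈okSet⇔)) (walk-map (from ∈okSet⇔)) (walk-within? okSet (<-wellFounded _) s t)
    where
      okSet : Subset (suc (size G))
      okSet = tabulate (does ∘ ok?)
      ∈okSet⇔ : u ∈ okSet ⇔ ok u
      ∈okSet⇔ {u} = ⇔-trans (∈-tabulate⇔ (does ∘ ok?)) (does≡true⇔ (ok? u))

  _~?_ : ∀ s t → Dec (s ~ t)
  _~?_ = walk? (λ _ → yes tt)

  Rank0⇒adj-invariant : ∀ {A} → Rank0 G A → adj G s t ≡ true → A s ≡ A t
  Rank0⇒adj-invariant {s} {t} {A} rank0 a with A s in As | A t in At
  ... | true  | true  = refl
  ... | false | false = refl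
  ... | true  | false = contradiction (trans (sym a) (rank0 s t As At)) λ ()
  ... | false | true  = contradiction (trans (sym a) (trans (adj-sym G s t) (rank0 t s At As))) λ ()

  Rank0⇒~-invariant : ∀ {A} → Rank0 G A → s ~ t → A s ≡ A t
  Rank0⇒~-invariant rank0 (here _)     = refl
  Rank0⇒~-invariant rank0 (step _ a W) = trans (Rank0⇒adj-invariant rank0 a) (Rank0⇒~-invariant rank0 W)

  ~-invariant⇒Rank0 : ∀ {A} → (∀ {s t} → s ~ t → A s ≡ A t) → Rank0 G A
  ~-invariant⇒Rank0 invariant u w Au Aw with adj G u w in e
  ... | false = refl
  ... | true  = contradiction (trans (sym Au) (trans (invariant (adj⇒~ e)) Aw)) λ ()

qr : ∀ {c v s} → Formula c v s → ℕ
qr (¬f φ)   = qr φ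
qr (φ ∧f ψ) = qr φ ⊔ qr ψ
qr (φ ∨f ψ) = qr φ ⊔ qr ψ
qr (∃f φ)   = suc (qr φ)
qr (∀f φ)   = suc (qr φ)
qr _        = 0

ext : ∀ {v w} → (Fin v → Fin w) → Fin (suc v) → Fin (suc w)
ext h zero    = zero
ext h (suc i) = suc (h i)

extend-ext : ∀ {A : Set} {v w} {h : Fin v → Fin w} {η : Fin w → A} {ρ : Fin v → A} a →
  (∀ i → η (h i) ≡ ρ i) → ∀ i → extend a η (ext h i) ≡ extend a ρ i
extend-ext a η∘h≗ρ zero    = refl
extend-ext a η∘h≗ρ (suc i) = η∘h≗ρ i

rename : ∀ {c v w s} → (Fin v → Fin w) → Formula c v s → Formula c w s
rename h tt              = tt
rename h ff              = ff
rename h (x ≐ y)         = h x ≐ h y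
rename h (edge x y)      = edge (h x) (h y)
rename h (colour i x)    = colour i (h x)
rename h (x ∈ₛ X)        = h x ∈ₛ X
rename h (conn k s t as) = conn k (h s) (h t) (Vec.map h as)
rename h (¬f φ)          = ¬f rename h φ
rename h (φ ∧f ψ)        = rename h φ ∧f rename h ψ
rename h (φ ∨f ψ)        = rename h φ ∨f rename h ψ
rename h (∃f φ)          = ∃f (rename (ext h) φ)
rename h (∀f φ)          = ∀f (rename (ext h) φ)

fullX : ∀ {c v} → Formula c v 1 → Formula c v 0
fullX (x ∈ₛ X)        = tt
fullX tt              = tt
fullX ff              = ff
fullX (x ≐ y)         = x ≐ y
fullX (edge x y)      = edge x y
fullX (colour i x)    = colour i x
fullX (conn k s t as) = conn k s t as
fullX (¬f φ)          = ¬f fullX φ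
fullX (φ ∧f ψ)        = fullX φ ∧f fullX ψ
fullX (φ ∨f ψ)        = fullX φ ∨f fullX ψ
fullX (∃f φ)          = ∃f (fullX φ)
fullX (∀f φ)          = ∀f (fullX φ)

⋀ : ∀ {c v s} n → (Fin n → Formula c v s) → Formula c v s
⋀ zero    φ = tt
⋀ (suc n) φ = φ zero ∧f ⋀ n (φ ∘ suc)

⋁ : ∀ {c v s} n → (Fin n → Formula c v s) → Formula c v s
⋁ zero    φ = ff
⋁ (suc n) φ = φ zero ∨f ⋁ n (φ ∘ suc)

conn₀ : ∀ {c v s} → Fin v → Fin v → Formula c v s
conn₀ x y = conn 0 x y []

lit : ∀ {c v s} → Bool → Formula c v s → Formula c v s
lit true  φ = φ
lit false φ = ¬f φ

exactly : ∀ {c v s n} → Vec Bool n → (Fin n → Formula c v s) → Formula c v s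
exactly bs φ = ⋀ _ (λ i → lit (lookup bs i) (φ i))

avoidSet : ∀ {w k} → Vec (Fin w) k → Subset w
avoidSet as = tabulate λ l → does (Any.any? (l ≟ᶠ_) as)

-- A local atom (i , α) at y over parameters ρ says that y lies in the component of ρ i and that
-- α holds of ρ i. In localFormula, variable zero stands for y and suc i for ρ i.
data Atom (c w : ℕ) : Set where
  self     : Atom c w
  same     : Fin w → Atom c w
  adjacent : Fin w → Atom c w
  reaches  : Fin w → Subset w → Atom c w
  coloured : Fin c → Atom c w

LocalAtom : ℕ → ℕ → Set
LocalAtom c w = Fin w × Atom c w

allAtoms : ∀ c w → List (Atom c w)
allAtoms c w = self ∷ List.map same (allFin w) ++ List.map adjacent (allFin w)
  ++ cartesianProductWith reaches (allFin w) (allVecs w) ++ List.map coloured (allFin c)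

∈-allAtoms : ∀ {c w} (α : Atom c w) → α ∈ₗ allAtoms c w
∈-allAtoms self = Anyₗ.here refl
∈-allAtoms {c} {w} (same j) = Anyₗ.there (∈-++⁺ˡ (∈-map⁺ same (∈-allFin j)))
∈-allAtoms {c} {w} (adjacent j) =
  Anyₗ.there (∈-++⁺ʳ (List.map same (allFin w)) (∈-++⁺ˡ (∈-map⁺ adjacent (∈-allFin j))))
∈-allAtoms {c} {w} (reaches j S) =
  Anyₗ.there (∈-++⁺ʳ (List.map same (allFin w)) (∈-++⁺ʳ (List.map adjacent (allFin w))
    (∈-++⁺ˡ (∈-cartesianProductWith⁺ reaches (∈-allFin j) (∈-allVecs S)))))
∈-allAtoms {c} {w} (coloured κ) =
  Anyₗ.there (∈-++⁺ʳ (List.map same (allFin w)) (∈-++⁺ʳ (List.map adjacent (allFin w))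
    (∈-++⁺ʳ (cartesianProductWith reaches (allFin w) (allVecs w)) (∈-map⁺ coloured (∈-allFin κ)))))

allLocalAtoms : ∀ c w → List (LocalAtom c w)
allLocalAtoms c w = cartesianProduct (allFin w) (allAtoms c w)

∈-allLocalAtoms : ∀ {c w} (δ : LocalAtom c w) → δ ∈ₗ allLocalAtoms c w
∈-allLocalAtoms (i , α) = ∈-cartesianProduct⁺ (∈-allFin i) (∈-allAtoms α)

atomFormula : ∀ {c w} → Fin (suc w) → Atom c w → Formula c (suc w) 0
atomFormula x self          = tt
atomFormula x (same j)      = x ≐ suc j
atomFormula x (adjacent j)  = edge x (suc j)
atomFormula x (reaches j S) = conn ∣ S ∣ x (suc j) (Vec.map suc (elements S))
atomFormula x (coloured κ)  = colour κ x

localFormula : ∀ {c w} → LocalAtom c w → Formula c (suc w) 0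
localFormula (i , α) = conn₀ zero (suc i) ∧f atomFormula (suc i) α

-- The rank-r local type of a vertex over w parameters, as a bit vector: the local atoms that hold,
-- followed for r > 0 by the characteristic vector, over allVecs, of the rank-(r - 1) types realised
-- in the same component with one more parameter.
typeLength : ℕ → ℕ → ℕ → ℕ
typeLength c zero    w = length (allLocalAtoms c w)
typeLength c (suc r) w = length (allLocalAtoms c w) + length (allVecs (typeLength c r (suc w)))

Type : ℕ → ℕ → ℕ → Set
Type c r w = Vec Bool (typeLength c r w)

atomsFormula : ∀ {c w u} → Vec Bool (length (allLocalAtoms c w)) → (Fin w → Fin u) → Fin u → Formula c u 0
atomsFormula {c} {w} bs g b =
  exactly bs λ l → rename (extend b g) (localFormula (List.lookup (allLocalAtoms c w) l))

hintikka : ∀ {c} r {w u} → Type c r w → (Fin w → Fin u) → Fin u → Formula c u 0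
hintikka zero        τ g b = atomsFormula τ g b
hintikka {c} (suc r) {w} τ g b =
  atomsFormula (Vec.take (length (allLocalAtoms c w)) τ) g b ∧f
  exactly (Vec.drop (length (allLocalAtoms c w)) τ)
    λ k → ∃f (conn₀ (suc b) zero ∧f hintikka r (List.lookup (allVecs _) k) (ext g) (suc b))

module Semantics {c} (G : Graph c) where
  open Connectivity G public

  variable
    v w k : ℕ
    ρ : Fin v → Vertex
    σ σ′ : Fin k → VSet G

  ⟦_⟧? : (ψ : Formula c v k) (ρ : Fin v → Vertex) (σ : Fin k → VSet G) → Dec (⟦ ψ ⟧ G ρ σ)
  ⟦ tt ⟧? ρ σ              = yes tt
  ⟦ ff ⟧? ρ σ              = no λ ()
  ⟦ x ≐ y ⟧? ρ σ           = ρ x ≟ᶠ ρ y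
  ⟦ edge x y ⟧? ρ σ        = adj G (ρ x) (ρ y) ≟ᵇ true
  ⟦ colour i x ⟧? ρ σ      = col G i (ρ x) ≟ᵇ true
  ⟦ x ∈ₛ X ⟧? ρ σ          = σ X (ρ x) ≟ᵇ true
  ⟦ conn k s t as ⟧? ρ σ   = walk? (λ u → ¬? (Any.any? (λ a → ρ a ≟ᶠ u) as)) (ρ s) (ρ t)
  ⟦ ¬f φ ⟧? ρ σ            = ¬? (⟦ φ ⟧? ρ σ)
  ⟦ φ ∧f ψ ⟧? ρ σ          = ⟦ φ ⟧? ρ σ ×-dec ⟦ ψ ⟧? ρ σ
  ⟦ φ ∨f ψ ⟧? ρ σ          = ⟦ φ ⟧? ρ σ ⊎-dec ⟦ ψ ⟧? ρ σ
  ⟦ ∃f φ ⟧? ρ σ            = any? λ a → ⟦ φ ⟧? (extend a ρ) σ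
  ⟦ ∀f φ ⟧? ρ σ            = all? λ a → ⟦ φ ⟧? (extend a ρ) σ

  ⟦rename⟧ : ∀ {η : Fin w → Vertex} (ψ : Formula c v k) (h : Fin v → Fin w) →
    (∀ i → η (h i) ≡ ρ i) → ⟦ rename h ψ ⟧ G η σ ⇔ ⟦ ψ ⟧ G ρ σ
  ⟦rename⟧ tt h η∘h≗ρ = ⇔-refl
  ⟦rename⟧ ff h η∘h≗ρ = ⇔-refl
  ⟦rename⟧ (x ≐ y) h η∘h≗ρ rewrite η∘h≗ρ x | η∘h≗ρ y = ⇔-refl
  ⟦rename⟧ (edge x y) h η∘h≗ρ rewrite η∘h≗ρ x | η∘h≗ρ y = ⇔-refl
  ⟦rename⟧ (colour i x) h η∘h≗ρ rewrite η∘h≗ρ x = ⇔-refl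
  ⟦rename⟧ (x ∈ₛ X) h η∘h≗ρ rewrite η∘h≗ρ x = ⇔-refl
  ⟦rename⟧ {η = η} (conn k s t as) h η∘h≗ρ rewrite η∘h≗ρ s | η∘h≗ρ t =
    walk-cong λ u → ¬-cong-⇔ (⇔-trans (Any-map⇔ h as) (mk⇔ (Any.map (trans (sym (η∘h≗ρ _))))
                                                          (Any.map (trans (η∘h≗ρ _)))))
  ⟦rename⟧ (¬f φ) h η∘h≗ρ   = ¬-cong-⇔ (⟦rename⟧ φ h η∘h≗ρ)
  ⟦rename⟧ (φ ∧f ψ) h η∘h≗ρ = ⟦rename⟧ φ h η∘h≗ρ ×-⇔ ⟦rename⟧ ψ h η∘h≗ρ
  ⟦rename⟧ (φ ∨f ψ) h η∘h≗ρ = ⟦rename⟧ φ h η∘h≗ρ ⊎-⇔ ⟦rename⟧ ψ h η∘h≗ρ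
  ⟦rename⟧ (∃f φ) h η∘h≗ρ   = Σ-cong-⇔ λ a → ⟦rename⟧ φ (ext h) (extend-ext a η∘h≗ρ)
  ⟦rename⟧ (∀f φ) h η∘h≗ρ   = Π-cong-⇔ λ a → ⟦rename⟧ φ (ext h) (extend-ext a η∘h≗ρ)

  ⟦fullX⟧ : (ψ : Formula c v 1) → ⟦ fullX ψ ⟧ G ρ noVars ⇔ ⟦ ψ ⟧ G ρ (λ _ _ → true)
  ⟦fullX⟧ (x ∈ₛ X)        = mk⇔ (const refl) (const tt)
  ⟦fullX⟧ tt              = ⇔-refl
  ⟦fullX⟧ ff              = ⇔-refl
  ⟦fullX⟧ (x ≐ y)         = ⇔-refl
  ⟦fullX⟧ (edge x y)      = ⇔-refl
  ⟦fullX⟧ (colour i x)    = ⇔-refl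
  ⟦fullX⟧ (conn k s t as) = ⇔-refl
  ⟦fullX⟧ (¬f φ)          = ¬-cong-⇔ (⟦fullX⟧ φ)
  ⟦fullX⟧ (φ ∧f ψ)        = ⟦fullX⟧ φ ×-⇔ ⟦fullX⟧ ψ
  ⟦fullX⟧ (φ ∨f ψ)        = ⟦fullX⟧ φ ⊎-⇔ ⟦fullX⟧ ψ
  ⟦fullX⟧ (∃f φ)          = Σ-cong-⇔ λ a → ⟦fullX⟧ φ
  ⟦fullX⟧ (∀f φ)          = Π-cong-⇔ λ a → ⟦fullX⟧ φ

  ⟦⟧-σ-cong : (ψ : Formula c v k) → (∀ X u → σ X u ≡ σ′ X u) → ⟦ ψ ⟧ G ρ σ ⇔ ⟦ ψ ⟧ G ρ σ′
  ⟦⟧-σ-cong {ρ = ρ} (x ∈ₛ X) σ≗σ′ rewrite σ≗σ′ X (ρ x) = ⇔-refl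
  ⟦⟧-σ-cong tt              σ≗σ′ = ⇔-refl
  ⟦⟧-σ-cong ff              σ≗σ′ = ⇔-refl
  ⟦⟧-σ-cong (x ≐ y)         σ≗σ′ = ⇔-refl
  ⟦⟧-σ-cong (edge x y)      σ≗σ′ = ⇔-refl
  ⟦⟧-σ-cong (colour i x)    σ≗σ′ = ⇔-refl
  ⟦⟧-σ-cong (conn k s t as) σ≗σ′ = ⇔-refl
  ⟦⟧-σ-cong (¬f φ)          σ≗σ′ = ¬-cong-⇔ (⟦⟧-σ-cong φ σ≗σ′)
  ⟦⟧-σ-cong (φ ∧f ψ)        σ≗σ′ = ⟦⟧-σ-cong φ σ≗σ′ ×-⇔ ⟦⟧-σ-cong ψ σ≗σ′
  ⟦⟧-σ-cong (φ ∨f ψ)        σ≗σ′ = ⟦⟧-σ-cong φ σ≗σ′ ⊎-⇔ ⟦⟧-σ-cong ψ σ≗σ′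
  ⟦⟧-σ-cong (∃f φ)          σ≗σ′ = Σ-cong-⇔ λ a → ⟦⟧-σ-cong φ σ≗σ′
  ⟦⟧-σ-cong (∀f φ)          σ≗σ′ = Π-cong-⇔ λ a → ⟦⟧-σ-cong φ σ≗σ′

  ⟦⋀⟧ : ∀ n (φ : Fin n → Formula c v k) → ⟦ ⋀ n φ ⟧ G ρ σ ⇔ (∀ i → ⟦ φ i ⟧ G ρ σ)
  ⟦⋀⟧ zero    φ = mk⇔ (λ _ ()) (const tt)
  ⟦⋀⟧ (suc n) φ = mk⇔
    (λ { (p , ps) zero → p ; (p , ps) (suc i) → to (⟦⋀⟧ n (φ ∘ suc)) ps i })
    (λ ps → ps zero , from (⟦⋀⟧ n (φ ∘ suc)) (ps ∘ suc))

  ⟦⋁⟧ : ∀ n (φ : Fin n → Formula c v k) → ⟦ ⋁ n φ ⟧ G ρ σ ⇔ Σ (Fin n) (λ i → ⟦ φ i ⟧ G ρ σ)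
  ⟦⋁⟧ zero    φ = mk⇔ (λ ()) (λ ())
  ⟦⋁⟧ (suc n) φ = mk⇔
    (λ { (inj₁ p) → zero , p ; (inj₂ q) → let i , p = to (⟦⋁⟧ n (φ ∘ suc)) q in suc i , p })
    (λ { (zero , p) → inj₁ p ; (suc i , p) → inj₂ (from (⟦⋁⟧ n (φ ∘ suc)) (i , p)) })

  ⟦conn₀⟧ : (x y : Fin v) → ⟦ conn₀ {c} {s = k} x y ⟧ G ρ σ ⇔ (ρ x ~ ρ y)
  ⟦conn₀⟧ x y = walk-cong λ u → mk⇔ (const tt) (λ _ ())

  ⟦lit⟧ : ∀ {η : Fin v → Vertex} {P : Set} (P? : Dec P) b (ψ : Formula c v k) →
    ⟦ ψ ⟧ G η σ ⇔ P → ⟦ lit b ψ ⟧ G η σ ⇔ (does P? ≡ b)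
  ⟦lit⟧ P? true  ψ ψ⇔P = ⇔-trans ψ⇔P (⇔-sym (does≡true⇔ P?))
  ⟦lit⟧ P? false ψ ψ⇔P = ⇔-trans (¬-cong-⇔ ψ⇔P) (⇔-sym (does≡false⇔ P?))

  ⟦exactly⟧ : ∀ {n} (bs : Vec Bool n) (φ : Fin n → Formula c v k) {P : Fin n → Set} (P? : Decidable P) →
    (∀ i → ⟦ φ i ⟧ G ρ σ ⇔ P i) → ⟦ exactly bs φ ⟧ G ρ σ ⇔ (tabulate (does ∘ P?) ≡ bs)
  ⟦exactly⟧ {ρ = ρ} {σ = σ} bs φ P? φ⇔P = begin
    ⟦ exactly bs φ ⟧ G ρ σ
      ∼⟨ ⟦⋀⟧ _ _ ⟩
    (∀ i → ⟦ lit (lookup bs i) (φ i) ⟧ G ρ σ)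
      ∼⟨ Π-cong-⇔ (λ i → ⟦lit⟧ (P? i) (lookup bs i) (φ i) (φ⇔P i)) ⟩
    (∀ i → does (P? i) ≡ lookup bs i)
      ∼⟨ ⇔-sym (tabulate-≡⇔ (does ∘ P?) bs) ⟩
    tabulate (does ∘ P?) ≡ bs
      ∎

module Types {c} (G : Graph c) where
  open Semantics G public

  variable
    r : ℕ
    y y′ : Vertex
    ρ′ : Fin w → Vertex

  Avoids : Subset w → (Fin w → Vertex) → Vertex → Set
  Avoids S ρ u = ¬ Σ (Fin _) λ l → l ∈ S × ρ l ≡ u

  Holds : (Fin w → Vertex) → Vertex → Atom c w → Set
  Holds ρ x self          = ⊤
  Holds ρ x (same j)      = x ≡ ρ j
  Holds ρ x (adjacent j)  = adj G x (ρ j) ≡ true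
  Holds ρ x (reaches j S) = Walk G (Avoids S ρ) x (ρ j)
  Holds ρ x (coloured κ)  = col G κ x ≡ true

  Local : (Fin w → Vertex) → Vertex → LocalAtom c w → Set
  Local ρ y (i , α) = y ~ ρ i × Holds ρ (ρ i) α

  holds? : (ρ : Fin w → Vertex) (x : Vertex) (α : Atom c w) → Dec (Holds ρ x α)
  holds? ρ x self          = yes tt
  holds? ρ x (same j)      = x ≟ᶠ ρ j
  holds? ρ x (adjacent j)  = adj G x (ρ j) ≟ᵇ true
  holds? ρ x (reaches j S) = walk? (λ u → ¬? (any? λ l → (l ∈? S) ×-dec (ρ l ≟ᶠ u))) x (ρ j)
  holds? ρ x (coloured κ)  = col G κ x ≟ᵇ true

  local? : (ρ : Fin w → Vertex) (y : Vertex) → Decidable (Local ρ y)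
  local? ρ y (i , α) = (y ~? ρ i) ×-dec holds? ρ (ρ i) α

  ⟦localFormula⟧ : (δ : LocalAtom c w) → ⟦ localFormula δ ⟧ G (extend y ρ) noVars ⇔ Local ρ y δ
  ⟦localFormula⟧ {y = y} {ρ = ρ} (i , α) = ⟦conn₀⟧ {σ = noVars} zero (suc i) ×-⇔ ⟦atomFormula⟧ α
    where
      ⟦atomFormula⟧ : (α : Atom c _) → ⟦ atomFormula (suc i) α ⟧ G (extend y ρ) noVars ⇔ Holds ρ (ρ i) α
      ⟦atomFormula⟧ self          = ⇔-refl
      ⟦atomFormula⟧ (same j)      = ⇔-refl
      ⟦atomFormula⟧ (adjacent j)  = ⇔-refl
      ⟦atomFormula⟧ (coloured κ)  = ⇔-refl
      ⟦atomFormula⟧ (reaches j S) = walk-cong λ u →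
        ¬-cong-⇔ (⇔-trans (Any-map⇔ suc (elements S)) (Any-elements⇔ S))

  Avoids-avoidSet⇔ : ∀ (as : Vec (Fin w) k) {u} → (¬ Any (λ a → ρ a ≡ u) as) ⇔ Avoids (avoidSet as) ρ u
  Avoids-avoidSet⇔ as = ¬-cong-⇔ (mk⇔
    (λ any → let l , l∈as , ρl≡u = find any in
      l , from (∈-tabulate⇔ _) (from (does≡true⇔ (Any.any? (l ≟ᶠ_) as)) l∈as) , ρl≡u)
    (λ (l , l∈S , ρl≡u) → lose (to (does≡true⇔ (Any.any? (l ≟ᶠ_) as)) (to (∈-tabulate⇔ _) l∈S)) ρl≡u))

  atoms : (Fin w → Vertex) → Vertex → Vec Bool (length (allLocalAtoms c w))
  atoms ρ y = Enumeration.χ (allLocalAtoms c _) ∈-allLocalAtoms (local? ρ y)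

  atoms-≡⇔ : ∀ (ρ : Fin w → Vertex) y ρ′ y′ → atoms ρ y ≡ atoms ρ′ y′ ⇔ (∀ δ → Local ρ y δ ⇔ Local ρ′ y′ δ)
  atoms-≡⇔ ρ y ρ′ y′ =
    Enumeration.χ-≡⇔ (allLocalAtoms c _) ∈-allLocalAtoms (local? ρ y) (local? ρ′ y′)

  mutual
    tp : ∀ r → (Fin w → Vertex) → Vertex → Type c r w
    tp zero    ρ y = atoms ρ y
    tp (suc r) ρ y = atoms ρ y Vec.++ Enumeration.χ (allVecs _) ∈-allVecs (realised? r ρ y)

    Realised : ∀ r → (Fin w → Vertex) → Vertex → Type c r (suc w) → Set
    Realised r ρ y τ = Σ Vertex λ a → y ~ a × tp r (extend a ρ) y ≡ τ

    realised? : ∀ r (ρ : Fin w → Vertex) y → Decidable (Realised r ρ y)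
    realised? r ρ y τ = any? λ a → (y ~? a) ×-dec (tp r (extend a ρ) y ≟ᵛ τ)

  -- A record rather than an equation of types, so that the positions can be inferred.
  infix 4 _≃[_]_
  record _≃[_]_ (p : (Fin w → Vertex) × Vertex) (r : ℕ) (p′ : (Fin w → Vertex) × Vertex) : Set where
    constructor ≃-intro
    field tp≡ : tp r (proj₁ p) (proj₂ p) ≡ tp r (proj₁ p′) (proj₂ p′)
  open _≃[_]_ public

  ≃-sym : (ρ , y) ≃[ r ] (ρ′ , y′) → (ρ′ , y′) ≃[ r ] (ρ , y)
  ≃-sym (≃-intro e) = ≃-intro (sym e)

  ≃-trans : ∀ {ρ″ : Fin w → Vertex} {y″} →
    (ρ , y) ≃[ r ] (ρ′ , y′) → (ρ′ , y′) ≃[ r ] (ρ″ , y″) → (ρ , y) ≃[ r ] (ρ″ , y″)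
  ≃-trans (≃-intro e) (≃-intro e′) = ≃-intro (trans e e′)

  Forth : ∀ r → (Fin w → Vertex) → Vertex → (Fin w → Vertex) → Vertex → Set
  Forth r ρ y ρ′ y′ = ∀ a → y ~ a → Σ Vertex λ a′ → y′ ~ a′ × (extend a ρ , y) ≃[ r ] (extend a′ ρ′ , y′)

  forth⇒realised : ∀ r → Forth r ρ y ρ′ y′ → ∀ τ → Realised r ρ y τ → Realised r ρ′ y′ τ
  forth⇒realised r forth τ (a , y~a , refl) =
    let a′ , y′~a′ , ≃-intro e = forth a y~a in a′ , y′~a′ , sym e

  realised⇒forth : ∀ r → (∀ τ → Realised r ρ y τ → Realised r ρ′ y′ τ) → Forth r ρ y ρ′ y′
  realised⇒forth r realised a y~a =
    let a′ , y′~a′ , e = realised _ (a , y~a , refl) in a′ , y′~a′ , ≃-intro (sym e)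

  tp-suc-≃⇔ : ∀ {r} {ρ ρ′ : Fin w → Vertex} {y y′} →
    (ρ , y) ≃[ suc r ] (ρ′ , y′) ⇔ (atoms ρ y ≡ atoms ρ′ y′ × Forth r ρ y ρ′ y′ × Forth r ρ′ y′ ρ y)
  tp-suc-≃⇔ {r = r} {ρ} {ρ′} {y} {y′} = mk⇔
    (λ (≃-intro e) → let R = to (realised-≡⇔) (++-injectiveʳ (atoms ρ y) (atoms ρ′ y′) e) in
           ++-injectiveˡ (atoms ρ y) (atoms ρ′ y′) e ,
           realised⇒forth r (λ τ → to (R τ)) , realised⇒forth r (λ τ → from (R τ)))
    (λ (atoms≡ , forth , back) → ≃-intro (cong₂ Vec._++_ atoms≡
       (from realised-≡⇔ λ τ → mk⇔ (forth⇒realised r forth τ) (forth⇒realised r back τ))))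
    where
      realised-≡⇔ = Enumeration.χ-≡⇔ (allVecs _) ∈-allVecs (realised? r ρ y) (realised? r ρ′ y′)

  tp⇒atoms : (ρ , y) ≃[ r ] (ρ′ , y′) → atoms ρ y ≡ atoms ρ′ y′
  tp⇒atoms {r = zero}  (≃-intro e) = e
  tp⇒atoms {r = suc r} p≃p′        = proj₁ (to tp-suc-≃⇔ p≃p′)

  tp-forth : (ρ , y) ≃[ suc r ] (ρ′ , y′) → Forth r ρ y ρ′ y′
  tp-forth p≃p′ = proj₁ (proj₂ (to tp-suc-≃⇔ p≃p′))

  tp-intro : atoms ρ y ≡ atoms ρ′ y′ → Forth r ρ y ρ′ y′ → Forth r ρ′ y′ ρ y → (ρ , y) ≃[ suc r ] (ρ′ , y′)
  tp-intro atoms≡ forth back = from tp-suc-≃⇔ (atoms≡ , forth , back)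

  atoms-~ : ∀ (ρ : Fin w → Vertex) → y ~ y′ → atoms ρ y ≡ atoms ρ y′
  atoms-~ ρ y~y′ = from (atoms-≡⇔ ρ _ ρ _) λ _ → mk⇔ (map₁ (~-trans (~-sym y~y′))) (map₁ (~-trans y~y′))

  tp-~ : ∀ r → y ~ y′ → (ρ , y) ≃[ r ] (ρ , y′)
  tp-~ {ρ = ρ} zero    y~y′ = ≃-intro (atoms-~ ρ y~y′)
  tp-~ {ρ = ρ} (suc r) y~y′ = tp-intro (atoms-~ ρ y~y′)
    (λ a y~a → a , ~-trans (~-sym y~y′) y~a , tp-~ r y~y′)
    (λ a y′~a → a , ~-trans y~y′ y′~a , tp-~ r (~-sym y~y′))

  tp-suc⇒tp : (ρ , y) ≃[ suc r ] (ρ′ , y′) → (ρ , y) ≃[ r ] (ρ′ , y′)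
  tp-suc⇒tp {r = zero}  p≃p′ = ≃-intro (tp⇒atoms p≃p′)
  tp-suc⇒tp {r = suc r} p≃p′ = let atoms≡ , forth , back = to tp-suc-≃⇔ p≃p′ in
    tp-intro atoms≡ (lower forth) (lower back)
    where
      lower : ∀ {ρ y ρ′ y′} → Forth (suc r) ρ y ρ′ y′ → Forth r ρ y ρ′ y′
      lower forth a y~a = let a′ , y′~a′ , q = forth a y~a in a′ , y′~a′ , tp-suc⇒tp q

  tp-≤ : ∀ {r q} → r ≤ q → (ρ , y) ≃[ q ] (ρ′ , y′) → (ρ , y) ≃[ r ] (ρ′ , y′)
  tp-≤ = go ∘ ≤⇒≤′
    where
      go : ∀ {r q} → r ≤′ q → (ρ , y) ≃[ q ] (ρ′ , y′) → (ρ , y) ≃[ r ] (ρ′ , y′)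
      go ≤′-refl            p≃p′ = p≃p′
      go (≤′-step {q} r≤′q) p≃p′ = go r≤′q (tp-suc⇒tp p≃p′)

  local-same⇒~ : ∀ {θ : Fin w → Vertex} {i j} → Local θ y (i , same j) → y ~ θ j
  local-same⇒~ {y = y} (y~ , e) = subst (y ~_) e y~

  local-adjacent⇒~ : ∀ {θ : Fin w → Vertex} {i j} → Local θ y (i , adjacent j) → y ~ θ j
  local-adjacent⇒~ (y~ , a) = ~-trans y~ (adj⇒~ a)

  local-reaches⇒~ : ∀ {θ : Fin w → Vertex} {i j S} → Local θ y (i , reaches j S) → y ~ θ j
  local-reaches⇒~ (y~ , W) = ~-trans y~ (walk⇒~ W)

  record Extends {w w′} (f : Fin w → Fin w′) (ρ : Fin w → Vertex) (θ : Fin w′ → Vertex) (y : Vertex) :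
                 Set where
    field
      agrees : ∀ i → θ (f i) ≡ ρ i
      far    : ∀ j → ¬ Σ (Fin w) (λ i → f i ≡ j) → y ≁ θ j
  open Extends public

  image? : ∀ {w w′} (f : Fin w → Fin w′) j → Dec (Σ (Fin w) λ i → f i ≡ j)
  image? f j = any? λ i → f i ≟ᶠ j

  Extends-ext : ∀ {w w′} {f : Fin w → Fin w′} {ρ θ} a →
    Extends f ρ θ y → Extends (ext f) (extend a ρ) (extend a θ) y
  Extends-ext a E .agrees = extend-ext a (agrees E)
  Extends-ext a E .far zero    ∉image = ⊥-elim (∉image (zero , refl))
  Extends-ext a E .far (suc j) ∉image = far E j λ (i , fi≡j) → ∉image (suc i , cong suc fi≡j)

  module Pull {w w′} {f : Fin w → Fin w′} {ρ θ y} (E : Extends f ρ θ y) where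

    self⇔ : ∀ i → Local θ y (f i , self) ⇔ Local ρ y (i , self)
    self⇔ i rewrite agrees E i = ⇔-refl

    coloured⇔ : ∀ i κ → Local θ y (f i , coloured κ) ⇔ Local ρ y (i , coloured κ)
    coloured⇔ i κ rewrite agrees E i = ⇔-refl

    same⇔ : ∀ i j → Local θ y (f i , same (f j)) ⇔ Local ρ y (i , same j)
    same⇔ i j rewrite agrees E i | agrees E j = ⇔-refl

    adjacent⇔ : ∀ i j → Local θ y (f i , adjacent (f j)) ⇔ Local ρ y (i , adjacent j)
    adjacent⇔ i j rewrite agrees E i | agrees E j = ⇔-refl

    reaches⇔ : ∀ i j S → Local θ y (f i , reaches (f j) S) ⇔ Local ρ y (i , reaches j (pullback f S))
    reaches⇔ i j S rewrite agrees E i | agrees E j =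
      mk⇔ (map₂ (walk-map avoids⇒)) (λ (y~ρi , W) → y~ρi , walk-map (avoids⇐ y~ρi) (walk-in-component W))
      where
        avoids⇒ : ∀ {u} → Avoids S θ u → Avoids (pullback f S) ρ u
        avoids⇒ avoids (l , l∈ , ρl≡u) = avoids (f l , to (∈-pullback⇔ f) l∈ , trans (agrees E l) ρl≡u)
        avoids⇐ : ∀ {u} → y ~ ρ i → Avoids (pullback f S) ρ u × ρ i ~ u → Avoids S θ u
        avoids⇐ y~ρi (avoids , ρi~u) (l′ , l′∈S , θl′≡u) with image? f l′
        ... | yes (l , refl) = avoids (l , from (∈-pullback⇔ f) l′∈S , trans (sym (agrees E l)) θl′≡u)
        ... | no l′∉image   = far E l′ l′∉image (subst (y ~_) (sym θl′≡u) (~-trans y~ρi ρi~u))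

  local-transport : ∀ {w w′} {f : Fin w → Fin w′} {ρ ρ′ θ θ′} → Extends f ρ θ y → Extends f ρ′ θ′ y′ →
    (∀ δ → Local ρ y δ ⇔ Local ρ′ y′ δ) → ∀ δ → Local θ y δ ⇔ Local θ′ y′ δ
  local-transport {y = y} {y′ = y′} {f = f} {ρ} {ρ′} {θ} {θ′} E E′ L (i′ , α) with image? f i′
  ... | no i′∉image = ¬×¬⇒⇔ (far E i′ i′∉image ∘ proj₁) (far E′ i′ i′∉image ∘ proj₁)
  ... | yes (i , refl) = anchored α
    where
      module P = Pull E
      module P′ = Pull E′
      through : ∀ α′ δ → Local θ y (f i , α′) ⇔ Local ρ y δ → Local θ′ y′ (f i , α′) ⇔ Local ρ′ y′ δ →
        Local θ y (f i , α′) ⇔ Local θ′ y′ (f i , α′)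
      through α′ δ pull pull′ = ⇔-trans pull (⇔-trans (L δ) (⇔-sym pull′))
      anchored : ∀ α → Local θ y (f i , α) ⇔ Local θ′ y′ (f i , α)
      anchored self         = through self (i , self) (P.self⇔ i) (P′.self⇔ i)
      anchored (coloured κ) = through (coloured κ) (i , coloured κ) (P.coloured⇔ i κ) (P′.coloured⇔ i κ)
      anchored (same j′) with image? f j′
      ... | yes (j , refl) = through (same (f j)) (i , same j) (P.same⇔ i j) (P′.same⇔ i j)
      ... | no j′∉image   =
        ¬×¬⇒⇔ (far E j′ j′∉image ∘ local-same⇒~ {θ = θ}) (far E′ j′ j′∉image ∘ local-same⇒~ {θ = θ′})
      anchored (adjacent j′) with image? f j′
      ... | yes (j , refl) = through (adjacent (f j)) (i , adjacent j) (P.adjacent⇔ i j) (P′.adjacent⇔ i j)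
      ... | no j′∉image   =
        ¬×¬⇒⇔ (far E j′ j′∉image ∘ local-adjacent⇒~ {θ = θ}) (far E′ j′ j′∉image ∘ local-adjacent⇒~ {θ = θ′})
      anchored (reaches j′ S) with image? f j′
      ... | yes (j , refl) =
        through (reaches (f j) S) (i , reaches j (pullback f S)) (P.reaches⇔ i j S) (P′.reaches⇔ i j S)
      ... | no j′∉image   =
        ¬×¬⇒⇔ (far E j′ j′∉image ∘ local-reaches⇒~ {θ = θ}) (far E′ j′ j′∉image ∘ local-reaches⇒~ {θ = θ′})

  atoms-transport : ∀ {w w′} {f : Fin w → Fin w′} {ρ ρ′ θ θ′} → Extends f ρ θ y → Extends f ρ′ θ′ y′ →
    atoms ρ y ≡ atoms ρ′ y′ → atoms θ y ≡ atoms θ′ y′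
  atoms-transport {y = y} {y′ = y′} {ρ = ρ} {ρ′} {θ} {θ′} E E′ atoms≡ =
    from (atoms-≡⇔ θ y θ′ y′) (local-transport E E′ (to (atoms-≡⇔ ρ y ρ′ y′) atoms≡))

  tp-transport : ∀ r {w w′} {f : Fin w → Fin w′} {ρ ρ′ θ θ′} → Extends f ρ θ y → Extends f ρ′ θ′ y′ →
    (ρ , y) ≃[ r ] (ρ′ , y′) → (θ , y) ≃[ r ] (θ′ , y′)
  tp-transport zero    E E′ (≃-intro atoms≡) = ≃-intro (atoms-transport E E′ atoms≡)
  tp-transport (suc r) E E′ p≃p′ = let atoms≡ , forth , back = to tp-suc-≃⇔ p≃p′ in
    tp-intro (atoms-transport E E′ atoms≡) (transport-forth E E′ forth) (transport-forth E′ E back)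
    where
      transport-forth : ∀ {w w′} {f : Fin w → Fin w′} {ρ ρ′ θ θ′ y y′} →
        Extends f ρ θ y → Extends f ρ′ θ′ y′ → Forth r ρ y ρ′ y′ → Forth r θ y θ′ y′
      transport-forth E E′ forth a y~a = let a′ , y′~a′ , q = forth a y~a in
        a′ , y′~a′ , tp-transport r (Extends-ext a E) (Extends-ext a′ E′) q

module HintikkaSemantics {c} (G : Graph c) where
  open Types G

  ⟦atomsFormula⟧ : ∀ {u} (bs : Vec Bool (length (allLocalAtoms c w))) (g : Fin w → Fin u) b
    {η : Fin u → Vertex} → (∀ i → η (g i) ≡ ρ i) → ⟦ atomsFormula bs g b ⟧ G η noVars ⇔ (atoms ρ (η b) ≡ bs)
  ⟦atomsFormula⟧ {ρ = ρ} bs g b {η} η∘g≗ρ = ⟦exactly⟧ bs _ (local? ρ (η b) ∘ atomAt)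
    λ l → ⇔-trans (⟦rename⟧ (localFormula (atomAt l)) (extend b g) η∘extend≗) (⟦localFormula⟧ (atomAt l))
    where
      atomAt = List.lookup (allLocalAtoms c _)
      η∘extend≗ : ∀ i → η (extend b g i) ≡ extend (η b) ρ i
      η∘extend≗ zero    = refl
      η∘extend≗ (suc i) = η∘g≗ρ i

  ⟦hintikka⟧ : ∀ r {u} (τ : Type c r w) (g : Fin w → Fin u) b {η : Fin u → Vertex} →
    (∀ i → η (g i) ≡ ρ i) → ⟦ hintikka r τ g b ⟧ G η noVars ⇔ (tp r ρ (η b) ≡ τ)
  ⟦hintikka⟧ zero    τ g b η∘g≗ρ = ⟦atomsFormula⟧ τ g b η∘g≗ρ
  ⟦hintikka⟧ {w = w} {ρ = ρ} (suc r) τ g b {η} η∘g≗ρ = begin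
    ⟦ hintikka (suc r) τ g b ⟧ G η noVars
      ∼⟨ ⟦atomsFormula⟧ (Vec.take n τ) g b η∘g≗ρ
         ×-⇔ ⟦exactly⟧ (Vec.drop n τ) _ (realised? r ρ (η b) ∘ List.lookup (allVecs _)) (λ k → Σ-cong-⇔ λ a →
               ⟦conn₀⟧ {σ = noVars} (suc b) zero ×-⇔ ⟦hintikka⟧ r _ (ext g) (suc b) (extend-ext a η∘g≗ρ)) ⟩
    (atoms ρ (η b) ≡ Vec.take n τ × _ ≡ Vec.drop n τ)
      ∼⟨ ⇔-sym (++-≡⇔ n _ _ τ) ⟩
    tp (suc r) ρ (η b) ≡ τ
      ∎
    where n = length (allLocalAtoms c w)

module Game {c} (G : Graph c) (Q : ℕ) where
  open Types G public

  variable
    A A′ : VSet G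
    a z : Vertex
    P : Vertex → Set
    τ : Type c Q 0
    β : Bool

  Untouched : (Fin w → Vertex) → Vertex → Set
  Untouched ρ y = ∀ i → ρ i ≁ y

  record Free (A : VSet G) (ρ : Fin w → Vertex) (τ : Type c Q 0) (β : Bool) (y : Vertex) : Set where
    constructor free
    field
      untouched : Untouched ρ y
      type≡     : tp Q noVars y ≡ τ
      colour≡   : A y ≡ β
  open Free public

  Free-extend⇔ : Free A (extend a ρ) τ β z ⇔ (Free A ρ τ β z × a ≁ z)
  Free-extend⇔ = mk⇔
    (λ (free u t b) → free (u ∘ suc) t b , u zero)
    (λ (free u t b , a≁z) → free (λ { zero → a≁z ; (suc i) → u i }) t b)

  record Apart (P : Vertex → Set) (k : ℕ) : Set where
    constructor apart
    field
      points   : List Vertex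
      length≡  : length points ≡ k
      pairwise : AllPairs _≁_ points
      all      : All P points

  Apart-map : ∀ {P′ : Vertex → Set} {k} → (∀ {z} → P z → P′ z) → Apart P k → Apart P′ k
  Apart-map f (apart zs len pw ps) = apart zs len pw (All.map f ps)

  Apart-refine : ∀ {P′ : Vertex → Set} {k} (X : Apart P k) →
    (∀ {z} → z ∈ₗ Apart.points X → P z → P′ z) → Apart P′ k
  Apart-refine (apart zs len pw ps) f = apart zs len pw (All.tabulate λ z∈ → f z∈ (All.lookup ps z∈))

  Apart-single : P a → Apart P 1
  Apart-single {a = a} pa = apart (a ∷ []) refl ([] ∷ []) (pa ∷ [])

  Apart-1⇒ : Apart P 1 → Σ Vertex P
  Apart-1⇒ (apart (z ∷ []) _ _ (pz ∷ [])) = z , pz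

  Apart-cons : ∀ {k} → P a → Apart (λ z → P z × a ≁ z) k → Apart P (suc k)
  Apart-cons pa (apart zs len pw ps) =
    apart (_ ∷ zs) (cong suc len) (All.map proj₂ ps ∷ pw) (pa ∷ All.map proj₁ ps)

  Apart-≤ : ∀ {k n} → k ≤ n → Apart P n → Apart P k
  Apart-≤ = go ∘ ≤⇒≤′
    where
      go : ∀ {k n} → k ≤′ n → Apart P n → Apart P k
      go ≤′-refl       A = A
      go (≤′-step k≤′n) (apart (_ ∷ zs) len (_ ∷ pw) (_ ∷ ps)) =
        go k≤′n (apart zs (suc-injective len) pw ps)

  outside : Vertex → List Vertex → List Vertex
  outside a = filter (λ z → ¬? (a ~? z))

  length-outside : ∀ a {zs} → AllPairs _≁_ zs → length zs ≤ suc (length (outside a zs))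
  length-outside a [] = z≤n
  length-outside a {x ∷ xs} (x≁xs ∷ pw) with a ~? x
  ... | yes a~x rewrite filter-reject (λ z → ¬? (a ~? z)) {x} {xs} (λ a≁x → a≁x a~x)
                      | filter-all (λ z → ¬? (a ~? z)) (All.map (λ x≁z → x≁z ∘ ~-trans (~-sym a~x)) x≁xs)
                      = ≤-refl
  ... | no a≁x rewrite filter-accept (λ z → ¬? (a ~? z)) {x} {xs} a≁x = s≤s (length-outside a pw)

  Apart-avoid : ∀ {k} a → Apart P (suc k) → Apart (λ z → P z × a ≁ z) k
  Apart-avoid a (apart zs len pw ps) =
    Apart-≤ (≤-pred (subst (_≤ suc (length (outside a zs))) len (length-outside a pw)))
      (apart (outside a zs) refl (AllPairs-filter⁺ _ pw) (All.zip (All-filter⁺ _ ps , all-filter _ zs)))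

  Counts : ℕ → VSet G → (Fin w → Vertex) → VSet G → (Fin w → Vertex) → Set
  Counts r A ρ A′ ρ′ = ∀ τ β k → k ≤ r → Apart (Free A ρ τ β) k → Apart (Free A′ ρ′ τ β) k

  -- Duplicator's invariant with r rounds left.
  record Similar (r : ℕ) (A : VSet G) (ρ : Fin w → Vertex) (A′ : VSet G) (ρ′ : Fin w → Vertex) : Set where
    field
      types   : ∀ i → (ρ , ρ i) ≃[ r ] (ρ′ , ρ′ i)
      colours : ∀ i → A (ρ i) ≡ A′ (ρ′ i)
      counts  : Counts r A ρ A′ ρ′
      counts⁻ : Counts r A′ ρ′ A ρ
  open Similar

  Similar-sym : Similar r A ρ A′ ρ′ → Similar r A′ ρ′ A ρ
  Similar-sym S = record
    { types = ≃-sym ∘ types S ; colours = sym ∘ colours S ; counts = counts⁻ S ; counts⁻ = counts S }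

  Extends-suc : y ≁ a → Extends suc ρ (extend a ρ) y
  Extends-suc y≁a .agrees i = refl
  Extends-suc y≁a .far zero    _       = y≁a
  Extends-suc y≁a .far (suc j) ∉image = ⊥-elim (∉image (j , refl))

  Extends-only : Untouched ρ a → Extends (λ (_ : Fin 1) → zero) (extend a noVars) (extend a ρ) a
  Extends-only ua .agrees zero = refl
  Extends-only ua .far zero    ∉image = ⊥-elim (∉image (zero , refl))
  Extends-only ua .far (suc j) _      = ua j ∘ ~-sym

  counts-near : ∀ {i i′ a′} → ρ i ~ a → ρ′ i′ ~ a′ →
    Counts (suc r) A ρ A′ ρ′ → Counts r A (extend a ρ) A′ (extend a′ ρ′)
  counts-near {i′ = i′} ρi~a ρ′i′~a′ C τ β k k≤r =
    Apart-map (λ F′ → from Free-extend⇔ (F′ , λ a′~z → untouched F′ i′ (~-trans ρ′i′~a′ a′~z)))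
    ∘ C τ β k (m≤n⇒m≤1+n k≤r) ∘ Apart-map (proj₁ ∘ to Free-extend⇔)

  similar-near : Rank0 G A → Rank0 G A′ → Similar (suc r) A ρ A′ ρ′ →
    ∀ i → ρ i ~ a → Σ Vertex λ a′ → Similar r A (extend a ρ) A′ (extend a′ ρ′)
  similar-near {A = A} {A′ = A′} {r = r} {ρ = ρ} {ρ′ = ρ′} {a = a} rA rA′ S i ρi~a = a′ , record
    { types = types′ ; colours = colours′
    ; counts = counts-near ρi~a ρ′i~a′ (counts S) ; counts⁻ = counts-near ρ′i~a′ ρi~a (counts⁻ S) }
    where
      forth = tp-forth (types S i) a ρi~a
      a′ = proj₁ forth
      ρ′i~a′ = proj₁ (proj₂ forth)
      moved = proj₂ (proj₂ forth)
      same-component⇔ : ∀ j → ρ i ~ ρ j ⇔ ρ′ i ~ ρ′ j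
      same-component⇔ j = let L = to (atoms-≡⇔ ρ (ρ i) ρ′ (ρ′ i)) (tp⇒atoms (types S i)) (j , self) in
        mk⇔ (λ ρi~ρj → proj₁ (to L (ρi~ρj , tt))) (λ ρ′i~ρ′j → proj₁ (from L (ρ′i~ρ′j , tt)))
      types′ : ∀ j → (extend a ρ , extend a ρ j) ≃[ r ] (extend a′ ρ′ , extend a′ ρ′ j)
      types′ zero = ≃-trans (tp-~ r (~-sym ρi~a)) (≃-trans moved (tp-~ r ρ′i~a′))
      types′ (suc j) with ρ i ~? ρ j
      ... | yes ρi~ρj =
        ≃-trans (tp-~ r (~-sym ρi~ρj)) (≃-trans moved (tp-~ r (to (same-component⇔ j) ρi~ρj)))
      ... | no ρi≁ρj  = tp-transport r
        (Extends-suc λ ρj~a → ρi≁ρj (~-trans ρi~a (~-sym ρj~a)))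
        (Extends-suc λ ρ′j~a′ → ρi≁ρj (from (same-component⇔ j) (~-trans ρ′i~a′ (~-sym ρ′j~a′))))
        (tp-suc⇒tp (types S j))
      colours′ : ∀ j → A (extend a ρ j) ≡ A′ (extend a′ ρ′ j)
      colours′ zero    =
        trans (Rank0⇒~-invariant rA (~-sym ρi~a)) (trans (colours S i) (Rank0⇒~-invariant rA′ ρ′i~a′))
      colours′ (suc j) = colours S j

  counts-far : ∀ {τₐ βₐ a′} → Rank0 G A′ → Free A ρ τₐ βₐ a → Free A′ ρ′ τₐ βₐ a′ →
    Counts (suc r) A ρ A′ ρ′ → Counts r A (extend a ρ) A′ (extend a′ ρ′)
  counts-far {A′ = A′} {ρ′ = ρ′} {τₐ = τₐ} {βₐ} {a′} rA′ Fa Fa′ C τ β k k≤r with (τ ≟ᵛ τₐ) ×-dec (β ≟ᵇ βₐ)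
  ... | yes (refl , refl) =
    -- the new pebbles use up one component of this kind on each side
    Apart-map (from Free-extend⇔) ∘ Apart-avoid a′ ∘ C τ β (suc k) (s≤s k≤r)
    ∘ Apart-cons Fa ∘ Apart-map (to Free-extend⇔)
  ... | no other-kind =
    Apart-map (λ F′ → from Free-extend⇔ (F′ , other-kind ∘ same-kind F′))
    ∘ C τ β k (m≤n⇒m≤1+n k≤r) ∘ Apart-map (proj₁ ∘ to Free-extend⇔)
    where
      same-kind : ∀ {z} → Free A′ ρ′ τ β z → a′ ~ z → τ ≡ τₐ × β ≡ βₐ
      same-kind F′ a′~z =
        trans (sym (type≡ F′)) (trans (sym (tp≡ (tp-~ {ρ = noVars} Q a′~z))) (type≡ Fa′)) ,
        trans (sym (colour≡ F′)) (trans (sym (Rank0⇒~-invariant rA′ a′~z)) (colour≡ Fa′))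

  similar-far : ∀ {r A A′ a} {ρ ρ′ : Fin w → Vertex} → suc r ≤ Q → Rank0 G A → Rank0 G A′ →
    Similar (suc r) A ρ A′ ρ′ → Untouched ρ a → Σ Vertex λ a′ → Similar r A (extend a ρ) A′ (extend a′ ρ′)
  similar-far {r = r} {A} {A′} {a} {ρ} {ρ′} r<Q rA rA′ S ua = a′ , record
    { types = types′ ; colours = colours′
    ; counts = counts-far rA′ Fa Fa′ (counts S) ; counts⁻ = counts-far rA Fa′ Fa (counts⁻ S) }
    where
      Fa : Free A ρ (tp Q noVars a) (A a) a
      Fa = free ua refl refl
      witness = Apart-1⇒ (counts S _ _ 1 (s≤s z≤n) (Apart-single Fa))
      Fb = proj₂ witness
      forth = tp-forth (tp-≤ r<Q (≃-intro (sym (type≡ Fb)))) a ~-refl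
      a′ = proj₁ forth
      b~a′ = proj₁ (proj₂ forth)
      a≃a′ : (extend a noVars , a) ≃[ r ] (extend a′ noVars , a′)
      a≃a′ = ≃-trans (proj₂ (proj₂ forth)) (tp-~ r b~a′)
      Fa′ : Free A′ ρ′ (tp Q noVars a) (A a) a′
      Fa′ = free (λ i ρ′i~a′ → untouched Fb i (~-trans ρ′i~a′ (~-sym b~a′)))
                 (trans (sym (tp≡ (tp-~ {ρ = noVars} Q b~a′))) (type≡ Fb))
                 (trans (sym (Rank0⇒~-invariant rA′ b~a′)) (colour≡ Fb))
      types′ : ∀ j → (extend a ρ , extend a ρ j) ≃[ r ] (extend a′ ρ′ , extend a′ ρ′ j)
      types′ zero    = tp-transport r (Extends-only ua) (Extends-only (untouched Fa′)) a≃a′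
      types′ (suc j) =
        tp-transport r (Extends-suc (ua j)) (Extends-suc (untouched Fa′ j)) (tp-suc⇒tp (types S j))
      colours′ : ∀ j → A (extend a ρ j) ≡ A′ (extend a′ ρ′ j)
      colours′ zero    = sym (colour≡ Fa′)
      colours′ (suc j) = colours S j

  similar-forth : suc r ≤ Q → Rank0 G A → Rank0 G A′ → Similar (suc r) A ρ A′ ρ′ →
    ∀ a → Σ Vertex λ a′ → Similar r A (extend a ρ) A′ (extend a′ ρ′)
  similar-forth {ρ = ρ} r<Q rA rA′ S a with any? (λ i → ρ i ~? a)
  ... | yes (i , ρi~a) = similar-near rA rA′ S i ρi~a
  ... | no untouched   = similar-far r<Q rA rA′ S λ i ρi~a → untouched (i , ρi~a)

  holds⇔ : Similar r A ρ A′ ρ′ → ∀ x α → Holds ρ (ρ x) α ⇔ Holds ρ′ (ρ′ x) α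
  holds⇔ {ρ = ρ} {ρ′ = ρ′} S x α =
    let L = to (atoms-≡⇔ ρ (ρ x) ρ′ (ρ′ x)) (tp⇒atoms (types S x)) (x , α) in
    mk⇔ (λ h → proj₂ (to L (~-refl , h))) (λ h → proj₂ (from L (~-refl , h)))

  similar⇒⇔ : ∀ (ψ : Formula c w 1) {r} → qr ψ ≤ r → r ≤ Q → Rank0 G A → Rank0 G A′ →
    Similar r A ρ A′ ρ′ → ⟦ ψ ⟧ G ρ (λ _ → A) ⇔ ⟦ ψ ⟧ G ρ′ (λ _ → A′)
  similar⇒⇔ tt           _ _ _ _ S = ⇔-refl
  similar⇒⇔ ff           _ _ _ _ S = ⇔-refl
  similar⇒⇔ (x ≐ y)      _ _ _ _ S = holds⇔ S x (same y)
  similar⇒⇔ (edge x y)   _ _ _ _ S = holds⇔ S x (adjacent y)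
  similar⇒⇔ (colour κ x) _ _ _ _ S = holds⇔ S x (coloured κ)
  similar⇒⇔ (x ∈ₛ X)     _ _ _ _ S = mk⇔ (trans (sym (colours S x))) (trans (colours S x))
  similar⇒⇔ (conn k s t as) _ _ _ _ S = ⇔-trans (walk-cong λ _ → Avoids-avoidSet⇔ as)
    (⇔-trans (holds⇔ S s (reaches t (avoidSet as))) (walk-cong λ _ → ⇔-sym (Avoids-avoidSet⇔ as)))
  similar⇒⇔ (¬f ψ)   q r≤Q rA rA′ S = ¬-cong-⇔ (similar⇒⇔ ψ q r≤Q rA rA′ S)
  similar⇒⇔ (φ ∧f ψ) q r≤Q rA rA′ S =
    similar⇒⇔ φ (m⊔n≤o⇒m≤o (qr φ) (qr ψ) q) r≤Q rA rA′ S
    ×-⇔ similar⇒⇔ ψ (m⊔n≤o⇒n≤o (qr φ) (qr ψ) q) r≤Q rA rA′ S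
  similar⇒⇔ (φ ∨f ψ) q r≤Q rA rA′ S =
    similar⇒⇔ φ (m⊔n≤o⇒m≤o (qr φ) (qr ψ) q) r≤Q rA rA′ S
    ⊎-⇔ similar⇒⇔ ψ (m⊔n≤o⇒n≤o (qr φ) (qr ψ) q) r≤Q rA rA′ S
  similar⇒⇔ (∃f ψ) (s≤s q) r<Q rA rA′ S = mk⇔
    (λ (a , p) → let a′ , S′ = similar-forth r<Q rA rA′ S a in
                 a′ , to (similar⇒⇔ ψ q (<⇒≤ r<Q) rA rA′ S′) p)
    (λ (a′ , p) → let a , S′ = similar-forth r<Q rA′ rA (Similar-sym S) a′ in
                  a , to (similar⇒⇔ ψ q (<⇒≤ r<Q) rA′ rA S′) p)
  similar⇒⇔ (∀f ψ) (s≤s q) r<Q rA rA′ S = mk⇔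
    (λ p a′ → let a , S′ = similar-forth r<Q rA′ rA (Similar-sym S) a′ in
              from (similar⇒⇔ ψ q (<⇒≤ r<Q) rA′ rA S′) (p a))
    (λ p a → let a′ , S′ = similar-forth r<Q rA rA′ S a in
             from (similar⇒⇔ ψ q (<⇒≤ r<Q) rA rA′ S′) (p a′))

module Construction {c} (G : Graph c) (Q : ℕ) (A : VSet G) (rank0 : Rank0 G A) where
  open Game G Q hiding (A; A′)

  record Cover (R : Vertex → Set) (N : ℕ) : Set where
    constructor cover
    field
      points  : List Vertex
      length≤ : length points ≤ N
      all     : All R points
      covers  : ∀ {y} → R y → Anyₗ.Any (y ~_) points

  greedy : (R : Vertex → Set) → Decidable R → ∀ N → Apart R (suc N) ⊎ Cover R N
  greedy R R? N = grow N refl (apart [] refl [] [])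
    where
      grow : ∀ f {m} → m + f ≡ N → Apart R m → Apart R (suc N) ⊎ Cover R N
      grow f {m} m+f≡N (apart zs len pw ps) with any? (λ y → R? y ×-dec ¬? (Anyₗ.any? (y ~?_) zs))
      ... | no none = inj₂ (cover zs (subst (_≤ N) (sym len) (subst (m ≤_) m+f≡N (m≤m+n m f))) ps covered)
        where
          covered : ∀ {y} → R y → Anyₗ.Any (y ~_) zs
          covered {y} Ry with Anyₗ.any? (y ~?_) zs
          ... | yes y~zs = y~zs
          ... | no y≁zs  = ⊥-elim (none (y , Ry , y≁zs))
      ... | yes (y , Ry , y≁zs) with apart (y ∷ zs) (cong suc len) (¬Any⇒All¬ zs y≁zs ∷ pw) (Ry ∷ ps) | f
      ...   | more | zero   = inj₁ (subst (Apart R) (cong suc (trans (sym (+-identityʳ m)) m+f≡N)) more)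
      ...   | more | suc f′ = grow f′ (trans (sym (+-suc m f′)) m+f≡N) more

  Kind : Type c Q 0 → Bool → Vertex → Set
  Kind = Free A noVars

  kind? : ∀ τ β → Decidable (Kind τ β)
  kind? τ β y = map′ (λ (t , b) → free (λ ()) t b) (λ F → type≡ F , colour≡ F)
    ((tp Q noVars y ≟ᵛ τ) ×-dec (A y ≟ᵇ β))

  data Plan (τ : Type c Q 0) : Set where
    fewIn  : Cover (Kind τ true) Q → Plan τ
    fewOut : Cover (Kind τ false) Q → Plan τ
    many   : Apart (Kind τ true) (suc Q) → Apart (Kind τ false) (suc Q) → Plan τ

  plan : ∀ τ → Plan τ
  plan τ with greedy (Kind τ true) (kind? τ true) Q
  ... | inj₂ C   = fewIn C
  ... | inj₁ ins with greedy (Kind τ false) (kind? τ false) Q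
  ...   | inj₂ C    = fewOut C
  ...   | inj₁ outs = many ins outs

  complemented : Plan τ → Bool
  complemented (fewOut _) = true
  complemented _          = false

  named : Plan τ → List Vertex
  named (fewIn C)    = Cover.points C
  named (fewOut C)   = Cover.points C
  named (many ins _) = Apart.points ins

  named-length : (p : Plan τ) → length (named p) ≤ suc Q
  named-length (fewIn C)    = m≤n⇒m≤1+n (Cover.length≤ C)
  named-length (fewOut C)   = m≤n⇒m≤1+n (Cover.length≤ C)
  named-length (many ins _) = ≤-reflexive (Apart.length≡ ins)

  Near : List Vertex → Vertex → Bool
  Near zs y = does (Anyₗ.any? (y ~?_) zs)

  Near-~ : ∀ zs → y ~ y′ → Near zs y ≡ Near zs y′
  Near-~ {y} {y′} zs y~y′ = does-⇔ (mk⇔ (Anyₗ.map (~-trans (~-sym y~y′))) (Anyₗ.map (~-trans y~y′)))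
    (Anyₗ.any? (y ~?_) zs) (Anyₗ.any? (y′ ~?_) zs)

  select : Plan τ → Vertex → Bool
  select p y = complemented p xor Near (named p) y

  A′ : VSet G
  A′ y = select (plan (tp Q noVars y)) y

  A′-~ : y ~ y′ → A′ y ≡ A′ y′
  A′-~ {y} {y′} y~y′ = trans (cong (λ τ → select (plan τ) y) (tp≡ (tp-~ Q y~y′)))
    (cong (complemented (plan (tp Q noVars y′)) xor_) (Near-~ (named (plan (tp Q noVars y′))) y~y′))

  rank0′ : Rank0 G A′
  rank0′ = ~-invariant⇒Rank0 A′-~

  Kind′ : Type c Q 0 → Bool → Vertex → Set
  Kind′ = Free A′ noVars

  A′-plan : ∀ {p : Plan τ} → plan τ ≡ p → tp Q noVars y ≡ τ → A′ y ≡ select p y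
  A′-plan {y = y} eq refl = cong (λ p → select p y) eq

  Near-colour : ∀ {zs} → All (λ p → A p ≡ β) zs → Near zs y ≡ true → A y ≡ β
  Near-colour {y = y} {zs = zs} ps near =
    let Ap≡β , y~p = All.lookupAny ps (to (does≡true⇔ (Anyₗ.any? (y ~?_) zs)) near) in
    trans (Rank0⇒~-invariant rank0 y~p) Ap≡β

  select-cover : (C : Cover (Kind τ β) Q) → tp Q noVars y ≡ τ → not β xor Near (Cover.points C) y ≡ A y
  select-cover {β = β} {y = y} (cover zs _ ps covers) t = not-xor β (mk⇔
    (Near-colour (All.map colour≡ ps))
    (λ Ay≡β → from (does≡true⇔ (Anyₗ.any? (y ~?_) zs)) (covers (free (λ ()) t Ay≡β))))

  Apart-agree : ∀ {k} → (∀ {y} → tp Q noVars y ≡ τ → A′ y ≡ A y) → Apart (Kind τ β) k ⇔ Apart (Kind′ τ β) k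
  Apart-agree agree = mk⇔
    (Apart-map λ (free u t b) → free u t (trans (agree t) b))
    (Apart-map λ (free u t b) → free u t (trans (sym (agree t)) b))

  many-both : ∀ {ins outs} → plan τ ≡ many ins outs → ∀ β →
    Apart (Kind τ β) (suc Q) × Apart (Kind′ τ β) (suc Q)
  many-both {ins = ins} {outs} eq true = ins , Apart-refine ins λ {z} z∈ Kz → free (λ ()) (type≡ Kz)
    (trans (A′-plan eq (type≡ Kz))
      (from (does≡true⇔ (Anyₗ.any? (z ~?_) _)) (Anyₗ.map (λ { refl → ~-refl }) z∈)))
  many-both {ins = ins} {outs} eq false = outs , Apart-refine outs λ {z} z∈ Kz → free (λ ()) (type≡ Kz)
    (trans (A′-plan eq (type≡ Kz)) (¬-not λ near →
      contradiction (trans (sym (Near-colour (All.map colour≡ (Apart.all ins)) near)) (colour≡ Kz)) λ ()))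

  counts-initial : ∀ τ β k → k ≤ Q → Apart (Kind τ β) k ⇔ Apart (Kind′ τ β) k
  counts-initial τ β k k≤Q with plan τ in eq
  ... | fewIn C       = Apart-agree λ t → trans (A′-plan eq t) (select-cover C t)
  ... | fewOut C      = Apart-agree λ t → trans (A′-plan eq t) (select-cover C t)
  ... | many ins outs = let X , X′ = many-both eq β in
    mk⇔ (λ _ → Apart-≤ (m≤n⇒m≤1+n k≤Q) X′) (λ _ → Apart-≤ (m≤n⇒m≤1+n k≤Q) X)

  similar-initial : Similar Q A noVars A′ noVars
  similar-initial = record
    { types   = λ ()
    ; colours = λ ()
    ; counts  = λ τ β k k≤Q → to (counts-initial τ β k k≤Q)
    ; counts⁻ = λ τ β k k≤Q → from (counts-initial τ β k k≤Q)
    }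

data Param (K S : ℕ) : Set where
  origin end : Param K S
  mode       : Fin K → Param K S
  slot used  : Fin K → Fin S → Param K S

paramCount : ℕ → ℕ → ℕ
paramCount K S = 2 + (K + (K * S + K * S))

module ParamLayout (K S : ℕ) where

  encode : Param K S → Fin (paramCount K S)
  encode origin     = zero
  encode end        = suc zero
  encode (mode k)   = suc (suc (k ↑ˡ (K * S + K * S)))
  encode (slot k l) = suc (suc (K ↑ʳ (combine k l ↑ˡ K * S)))
  encode (used k l) = suc (suc (K ↑ʳ (K * S ↑ʳ combine k l)))

  decode : Fin (paramCount K S) → Param K S
  decode zero             = origin
  decode (suc zero)       = end
  decode (suc (suc i)) =
    [ mode , [ uncurry slot ∘ remQuot {K} S , uncurry used ∘ remQuot {K} S ]′ ∘ splitAt (K * S) ]′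
      (splitAt K i)

  decode-encode : ∀ p → decode (encode p) ≡ p
  decode-encode origin = refl
  decode-encode end    = refl
  decode-encode (mode k) rewrite splitAt-↑ˡ K k (K * S + K * S) = refl
  decode-encode (slot k l) rewrite splitAt-↑ʳ K (K * S + K * S) (combine k l ↑ˡ K * S)
                                 | splitAt-↑ˡ (K * S) (combine k l) (K * S) =
    cong (uncurry slot) (remQuot-combine k l)
  decode-encode (used k l) rewrite splitAt-↑ʳ K (K * S + K * S) (K * S ↑ʳ combine k l)
                                 | splitAt-↑ʳ (K * S) (K * S) (combine k l) =
    cong (uncurry used) (remQuot-combine k l)

zero≡fromℕ⇒≡zero : ∀ {n} → zero ≡ fromℕ n → (u : Fin (suc n)) → u ≡ zero
zero≡fromℕ⇒≡zero {zero} _ zero = refl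

module Definability {c} (φ : Formula c 0 1) where

  Q : ℕ
  Q = qr φ

  allTypes : List (Type c Q 0)
  allTypes = allVecs (typeLength c Q 0)

  K S m : ℕ
  K = length allTypes
  S = suc Q
  m = paramCount K S

  open ParamLayout K S

  -- A parameter p encodes the bit p = origin; encoding false needs a vertex end ≠ origin, so the
  -- one-vertex graph is treated separately.
  var : Param K S → Fin (suc m)
  var p = suc (encode p)

  isSet : Param K S → Formula c (suc m) 0
  isSet p = var p ≐ var origin

  nearSlot : Fin K → Fin S → Formula c (suc m) 0
  nearSlot k l = isSet (used k l) ∧f conn₀ zero (var (slot k l))

  nearNamed : Fin K → Formula c (suc m) 0
  nearNamed k = ⋁ S (nearSlot k)

  selected : Fin K → Formula c (suc m) 0
  selected k = ((¬f isSet (mode k)) ∧f nearNamed k) ∨f (isSet (mode k) ∧f (¬f nearNamed k))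

  ofType : Fin K → Formula c (suc m) 0
  ofType k = hintikka Q (List.lookup allTypes k) (λ ()) zero ∧f selected k

  body : Formula c (suc m) 0
  body = ⋁ K ofType

  φ′ : Formula c (suc m) 0
  φ′ = ((var origin ≐ var end) ∧f rename (λ ()) (fullX φ)) ∨f ((¬f (var origin ≐ var end)) ∧f body)

  module _ (G : Graph c) where
    open Game G Q using (similar⇒⇔)
    open HintikkaSemantics G
    open Types G using (Vertex; tp; ⟦rename⟧; ⟦fullX⟧; ⟦⋁⟧; ⟦conn₀⟧; _~_; _~?_; ⟦_⟧?; ⟦⟧-σ-cong)

    Definable : Set
    Definable = Σ (VSet G) λ A′ → Σ (Fin m → V G) λ d →
      Rank0 G A′ × ⟦ φ ⟧ G noVars (λ _ → A′) × ((v : V G) → (A′ v ≡ true) ⇔ ⟦ φ′ ⟧ G (extend v d) noVars)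

    ⟦sentence⟧ : (η : Fin (suc m) → Vertex) →
      ⟦ rename (λ ()) (fullX φ) ⟧ G η noVars ⇔ ⟦ φ ⟧ G noVars (λ _ _ → true)
    ⟦sentence⟧ η = ⇔-trans (⟦rename⟧ (fullX φ) (λ ()) (λ ())) (⟦fullX⟧ φ)

    single-vertex : (∀ u → u ≡ zero) → ∀ A → ⟦ φ ⟧ G noVars (λ _ → A) → Definable
    single-vertex only-zero A φA with ⟦ φ ⟧? noVars (λ _ _ → true)
    ... | yes φV = (λ _ → true) , (λ _ → zero) , (λ _ _ _ ()) , φV ,
      λ v → mk⇔ (λ _ → inj₁ (refl , from (⟦sentence⟧ _) φV)) (λ _ → refl)
    ... | no ¬φV = (λ _ → false) , (λ _ → zero) , (λ _ _ ()) , φ∅ ,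
      λ v → mk⇔ (λ ()) λ { (inj₁ (_ , s)) → ⊥-elim (¬φV (to (⟦sentence⟧ _) s))
                         ; (inj₂ (o≢e , _)) → ⊥-elim (o≢e (trans (only-zero _) (sym (only-zero _)))) }
      where
        φ∅ : ⟦ φ ⟧ G noVars (λ _ _ → false)
        φ∅ with A zero in A0
        ... | true  = ⊥-elim (¬φV (to (⟦⟧-σ-cong φ λ _ u → trans (cong A (only-zero u)) A0) φA))
        ... | false = to (⟦⟧-σ-cong φ λ _ u → trans (cong A (only-zero u)) A0) φA

    module WithParameters (A : VSet G) (rank0 : Rank0 G A) (o≢e : zero ≢ fromℕ (size G)) where
      open Construction G Q A rank0

      o e : Vertex
      o = zero
      e = fromℕ (size G)

      bit : Bool → Vertex
      bit b = if b then o else e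

      planOf : (k : Fin K) → Plan (List.lookup allTypes k)
      planOf k = plan (List.lookup allTypes k)

      D : Param K S → Vertex
      D origin     = o
      D end        = e
      D (mode k)   = bit (complemented (planOf k))
      D (slot k l) = slotOf o (named (planOf k)) l
      D (used k l) = bit (occupied (named (planOf k)) l)

      d : Fin m → Vertex
      d = D ∘ decode

      ⟦var≐var⟧ : ∀ v p q → ⟦ var p ≐ var q ⟧ G (extend v d) noVars ⇔ (D p ≡ D q)
      ⟦var≐var⟧ v p q rewrite decode-encode p | decode-encode q = ⇔-refl

      ⟦isSet⟧ : ∀ v p b → D p ≡ bit b → ⟦ isSet p ⟧ G (extend v d) noVars ⇔ (b ≡ true)
      ⟦isSet⟧ v p true  Dp≡o = ⇔-trans (⟦var≐var⟧ v p origin) (mk⇔ (const refl) (const Dp≡o))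
      ⟦isSet⟧ v p false Dp≡e = ⇔-trans (⟦var≐var⟧ v p origin)
        (mk⇔ (λ Dp≡o → ⊥-elim (o≢e (trans (sym Dp≡o) Dp≡e))) λ ())

      ⟦nearNamed⟧ : ∀ v k → ⟦ nearNamed k ⟧ G (extend v d) noVars ⇔ (Near (named (planOf k)) v ≡ true)
      ⟦nearNamed⟧ v k = begin
        ⟦ nearNamed k ⟧ G (extend v d) noVars
          ∼⟨ ⟦⋁⟧ S (nearSlot k) ⟩
        Σ (Fin S) (λ l → ⟦ nearSlot k l ⟧ G (extend v d) noVars)
          ∼⟨ Σ-cong-⇔ (λ l → ⟦isSet⟧ v (used k l) (occupied L l) refl
                             ×-⇔ ⇔-trans (⟦conn₀⟧ {σ = noVars} zero (var (slot k l))) (slot≡ l)) ⟩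
        Σ (Fin S) (λ l → occupied L l ≡ true × v ~ slotOf o L l)
          ∼⟨ slots-Any⇔ (v ~_) o L (named-length (planOf k)) ⟩
        Anyₗ.Any (v ~_) L
          ∼⟨ ⇔-sym (does≡true⇔ (Anyₗ.any? (v ~?_) L)) ⟩
        Near L v ≡ true
          ∎
        where
          L = named (planOf k)
          slot≡ : ∀ l → (v ~ extend v d (var (slot k l))) ⇔ (v ~ slotOf o L l)
          slot≡ l rewrite decode-encode (slot k l) = ⇔-refl

      ⟦selected⟧ : ∀ v k → ⟦ selected k ⟧ G (extend v d) noVars ⇔ (select (planOf k) v ≡ true)
      ⟦selected⟧ v k = xor-⇔ (complemented (planOf k)) (Near (named (planOf k)) v)
        (⟦isSet⟧ v (mode k) (complemented (planOf k)) refl) (⟦nearNamed⟧ v k)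

      ⟦body⟧ : ∀ v → ⟦ body ⟧ G (extend v d) noVars ⇔ (A′ v ≡ true)
      ⟦body⟧ v = begin
        ⟦ body ⟧ G (extend v d) noVars
          ∼⟨ ⟦⋁⟧ K ofType ⟩
        Σ (Fin K) (λ k → ⟦ ofType k ⟧ G (extend v d) noVars)
          ∼⟨ Σ-cong-⇔ (λ k → ⟦hintikka⟧ {ρ = noVars} Q (List.lookup allTypes k) (λ ()) zero (λ ())
                            ×-⇔ ⟦selected⟧ v k) ⟩
        Σ (Fin K) (λ k → tp Q noVars v ≡ List.lookup allTypes k × select (planOf k) v ≡ true)
          ∼⟨ mk⇔ (λ (k , t , s) → subst (λ τ → select (plan τ) v ≡ true) (sym t) s)
                 (λ A′v → Anyₗ.index v∈ , lookup-index v∈ ,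
                          subst (λ τ → select (plan τ) v ≡ true) (lookup-index v∈) A′v) ⟩
        A′ v ≡ true
          ∎
        where v∈ = ∈-allVecs (tp Q noVars v)

      ⟦φ′⟧ : ∀ v → ⟦ φ′ ⟧ G (extend v d) noVars ⇔ (A′ v ≡ true)
      ⟦φ′⟧ v = mk⇔
        (λ { (inj₁ (o≡e , _)) → ⊥-elim (o≢e (to (⟦var≐var⟧ v origin end) o≡e))
           ; (inj₂ (_ , b))     → to (⟦body⟧ v) b })
        (λ A′v → inj₂ (o≢e ∘ to (⟦var≐var⟧ v origin end) , from (⟦body⟧ v) A′v))

      definable : ⟦ φ ⟧ G noVars (λ _ → A) → Definable
      definable φA =
        A′ , d , rank0′ , to (similar⇒⇔ φ ≤-refl ≤-refl rank0 rank0′ similar-initial) φA , ⇔-sym ∘ ⟦φ′⟧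

    definable : Σ (VSet G) (λ A → Rank0 G A × ⟦ φ ⟧ G noVars (λ _ → A)) → Definable
    definable (A , rank0 , φA) with zero ≟ᶠ fromℕ (size G)
    ... | yes o≡e = single-vertex (zero≡fromℕ⇒≡zero o≡e) A φA
    ... | no  o≢e = WithParameters.definable A rank0 o≢e φA

lemma4p2 : ∀ {c} (φ : Formula c 0 1) →
    Σ ℕ λ m → Σ (Formula c (suc m) 0) λ φ′ →
      (G : Graph c) →
      Σ (VSet G) (λ A → Rank0 G A × ⟦ φ ⟧ G noVars (λ _ → A)) →
      Σ (VSet G) λ A′ → Σ (Fin m → V G) λ d →
        Rank0 G A′ × ⟦ φ ⟧ G noVars (λ _ → A′) ×
        ((v : V G) → (A′ v ≡ true) ⇔ ⟦ φ′ ⟧ G (extend v d) noVars)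
lemma4p2 φ = m , φ′ , definable
  where open Definability φ
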